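{- Let $q$ be odd and $P$ an internal point. Let $\ell(P)$ be a tangent line through an external point of $P^\perp$, and let $T(P,\ell(P))$ be the set of tangent lines, different from $\ell(P)$, through the external points that lie on $\ell(P)$ and on some passant line through $P$. Then, as integer vectors indexed by the external points, $$\chi_{N_{Pa,E}(P)}\equiv\sum_{\ell\in T(P,\ell(P))}\chi_\ell\pmod 2$$ (entrywise congruence).
   Context: $\mathrm{PG}(2,q)$ has points $(a_0,a_1,a_2)$ and lines $[b_0,b_1,b_2]$ with incidence $a_0b_0+a_1b_1+a_2b_2=0$; $\mathcal{O}=\{(1,t,t^2):t\in\mathbb{F}_q\}\cup\{(0,0,1)\}$. Lines are passant/tangent/secant if they meet $\mathcal{O}$ in $0/1/2$ points; points off $\mathcal{O}$ are external/internal if on $2/0$ tangent lines; $E$ is the set of external points. The polarity $\perp$ maps $(x,y,z)$ to $[z,-2y,x]$. For $N\subseteq E$, $\chi_N\in\mathbb{Z}^E$ is its $0$-$1$ characteristic vector; for a line $\ell$, $\chi_\ell=\chi_{E\cap\ell}$. $N_{Pa,E}(P)$ is the set of external points lying on some passant line through $P$. -}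

module Defs where

open import Level using (0ℓ)
open import Data.Bool using (Bool; true; false; _∧_; _∨_; not; if_then_else_; T)
open import Data.Nat using (ℕ; zero; suc; _≡ᵇ_)
import Data.Nat as ℕ
open import Data.Integer using (ℤ; +_)
import Data.Integer as ℤ
open import Data.List using (List; []; _∷_; map; concatMap; length; foldr)
open import Data.Bool.ListAction using (any)
open import Data.List.Membership.Propositional using (_∈_)
open import Data.List.Relation.Unary.Unique.Propositional using (Unique)
open import Data.Product using (Σ; _×_; _,_; ∃)
open import Data.Sum using (_⊎_)
open import Relation.Nullary using (¬_)
open import Relation.Nullary.Decidable using (⌊_⌋)
open import Relation.Binary.PropositionalEquality using (_≡_; _≢_)
open import Relation.Binary.Definitions using (DecidableEquality)
open import Algebra.Structures using (IsCommutativeRing)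

record FiniteField : Set₁ where
  infixl 6 _+_
  infixl 7 _*_
  field
    Carrier : Set
    _+_ _*_ : Carrier → Carrier → Carrier
    -_      : Carrier → Carrier
    0# 1#   : Carrier
    isCommutativeRing : IsCommutativeRing _≡_ _+_ _*_ -_ 0# 1#
    0≢1     : 0# ≢ 1#
    inverse : ∀ x → x ≢ 0# → ∃ λ y → x * y ≡ 1#
    _≟_     : DecidableEquality Carrier
    elements : List Carrier
    elements-complete : ∀ x → x ∈ elements
    elements-unique   : Unique elements

  order : ℕ
  order = length elements

module PG2 (F : FiniteField) where
  open FiniteField F

  Triple : Set
  Triple = Carrier × Carrier × Carrier

  Normalized : Triple → Set
  Normalized (a , b , c) = (a ≡ 1#) ⊎ ((a ≡ 0#) × (b ≡ 1#)) ⊎ ((a ≡ 0#) × (b ≡ 0#) × (c ≡ 1#))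

  -- points of PG(2,q) (and, dually, lines [b0,b1,b2]) as canonical representatives
  Pt : Set
  Pt = Σ Triple Normalized

  Line : Set
  Line = Pt

  allTriples : List Triple
  allTriples =
    concatMap (λ b → map (λ c → (1# , b , c)) elements) elements
    Data.List.++ (map (λ c → (0# , 1# , c)) elements
    Data.List.++ ((0# , 0# , 1#) ∷ []))

  eqᵇ : Carrier → Carrier → Bool
  eqᵇ x y = ⌊ x ≟ y ⌋

  eqTᵇ : Triple → Triple → Bool
  eqTᵇ (a , b , c) (a' , b' , c') = eqᵇ a a' ∧ eqᵇ b b' ∧ eqᵇ c c'

  count : {A : Set} → (A → Bool) → List A → ℕ
  count p [] = 0
  count p (x ∷ xs) = if p x then suc (count p xs) else count p xs

  dot : Triple → Triple → Carrier
  dot (a0 , a1 , a2) (b0 , b1 , b2) = a0 * b0 + a1 * b1 + a2 * b2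

  incᵇ : Triple → Triple → Bool
  incᵇ x ℓ = eqᵇ (dot x ℓ) 0#

  onOᵇ : Triple → Bool
  onOᵇ x = any (λ t → eqTᵇ x (1# , t , t * t)) elements ∨ eqTᵇ x (0# , 0# , 1#)

  nO : Triple → ℕ
  nO ℓ = count (λ t → incᵇ (1# , t , t * t) ℓ) elements
         ℕ.+ (if incᵇ (0# , 0# , 1#) ℓ then 1 else 0)

  passantᵇ tangentᵇ secantᵇ : Triple → Bool
  passantᵇ ℓ = nO ℓ ≡ᵇ 0
  tangentᵇ ℓ = nO ℓ ≡ᵇ 1
  secantᵇ ℓ = nO ℓ ≡ᵇ 2

  nTan : Triple → ℕ
  nTan x = count (λ ℓ → tangentᵇ ℓ ∧ incᵇ x ℓ) allTriples

  externalᵇ internalᵇ : Triple → Bool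
  externalᵇ x = not (onOᵇ x) ∧ (nTan x ≡ᵇ 2)
  internalᵇ x = not (onOᵇ x) ∧ (nTan x ≡ᵇ 0)

  External Internal : Pt → Set
  External (x , _) = T (externalᵇ x)
  Internal (x , _) = T (internalᵇ x)

  Tangent Passant : Line → Set
  Tangent (ℓ , _) = T (tangentᵇ ℓ)
  Passant (ℓ , _) = T (passantᵇ ℓ)

  _on_ : Pt → Triple → Set
  (x , _) on ℓ = T (incᵇ x ℓ)

  perp : Triple → Triple
  perp (x , y , z) = (z , - ((1# + 1#) * y) , x)

  inNᵇ : Triple → Triple → Bool
  inNᵇ P R = externalᵇ R ∧ any (λ m → passantᵇ m ∧ incᵇ P m ∧ incᵇ R m) allTriples

  inTᵇ : Triple → Triple → Triple → Bool
  inTᵇ P ℓ m = tangentᵇ m ∧ not (eqTᵇ m ℓ)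
               ∧ any (λ R → inNᵇ P R ∧ incᵇ R ℓ ∧ incᵇ R m) allTriples

  -- characteristic vectors in ℤ^E (evaluated at an external point Q)
  χN : Pt → Pt → ℤ
  χN (P , _) (Q , _) = if inNᵇ P Q then + 1 else + 0

  χline : Triple → Pt → ℤ
  χline m (Q , _) = if externalᵇ Q ∧ incᵇ Q m then + 1 else + 0

  sumT : Pt → Line → Pt → ℤ
  sumT (P , _) (ℓ , _) Q =
    foldr (λ m acc → (if inTᵇ P ℓ m then χline m Q else + 0) ℤ.+ acc) (+ 0) allTriples

module Submission where

-- A line [a,b,c] is passant iff its discriminant b² − 4ac is a nonsquare; let η be the quadratic
-- character. For an internal point P and distinct tangents m, n meeting in X, the line PX has
-- discriminant (P·m)(P·n) times a nonzero square, and P lies on no tangent; so X ∈ N_{Pa,E}(P)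
-- iff η(P·m) ≠ η(P·n). Let m₁, m₂ be the tangents through the external point Q.
-- If Q ∉ ℓ(P), the conditions Q ∈ N_{Pa,E}(P), m₁ ∈ T(P,ℓ(P)) and m₂ ∈ T(P,ℓ(P)) read
-- η(P·m₁) ≠ η(P·m₂), η(P·ℓ(P)) ≠ η(P·m₁) and η(P·ℓ(P)) ≠ η(P·m₂), and an even number of them hold.
-- If Q ∈ ℓ(P), then ℓ(P) is one of the mᵢ and is not in T(P,ℓ(P)), while the other meets ℓ(P)
-- in Q, so it lies in T(P,ℓ(P)) iff Q ∈ N_{Pa,E}(P).

open import Defs
open import Data.Nat using (_%_)
open import Data.Integer using (ℤ; _-_; +_)
open import Data.Integer.Divisibility using (_∣_)
open import Data.Product using (Σ; _×_; proj₁)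
open import Relation.Binary.PropositionalEquality using (_≡_)

open import Data.Bool using (Bool; true; false; _∧_; _∨_; not; if_then_else_; _xor_)
import Data.Bool.Properties as Boolₚ
open import Data.Nat as ℕ using (ℕ; zero; suc; _<ᵇ_)
import Data.Nat.Properties as ℕₚ
import Data.Nat.DivMod as DivMod
open import Data.List using (List; []; _∷_; length; map; concatMap; _++_)
open import Data.List.Membership.Propositional using (_∈_; find; lose)
open import Data.List.Relation.Unary.Any as Any using (here; there)
open import Data.List.Relation.Unary.Any.Properties using (any⁺; any⁻)
open import Data.List.Relation.Unary.All as All using (All; []; _∷_)
open import Data.List.Relation.Unary.Unique.Propositional using (Unique)
open import Data.List.Relation.Unary.AllPairs as AllPairs using ([]; _∷_)
import Data.List.Relation.Unary.AllPairs.Properties as AllPairsₚ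
import Data.List.Relation.Unary.All.Properties as Allₚ
import Data.List.Relation.Unary.Unique.Propositional.Properties as Uniqueₚ
import Data.List.Membership.Propositional.Properties as ∈ₚ
open import Data.Bool.ListAction using (any)
open import Data.Product using (_,_; proj₂; ∃)
open import Data.Sum using (_⊎_; inj₁; inj₂)
open import Data.Empty using (⊥-elim)
open import Function using (Equivalence)
import Data.Maybe as Maybe
open import Relation.Nullary.Decidable using (dec⇒maybe)
open import Relation.Nullary using (¬_; yes; no)
open import Algebra.Bundles using (CommutativeRing)
import Algebra.Properties.Ring as RingProperties
import Algebra.Properties.CommutativeSemigroup as CommutativeSemigroupₚ
import Algebra.Solver.Ring.AlmostCommutativeRing as ACR
import Algebra.Solver.Ring as RingSolver
import Data.Integer as ℤ
import Data.Integer.Properties as ℤₚ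
import Data.Integer.Tactic.RingSolver as ℤSolver
open import Data.Integer.Divisibility.Signed using (divides; ∣⇒∣ᵤ)
open import Relation.Binary.PropositionalEquality using (refl; sym; trans; cong; cong₂; subst; _≢_; module ≡-Reasoning)

bool-ext : ∀ {a b} → (a ≡ true → b ≡ true) → (b ≡ true → a ≡ true) → a ≡ b
bool-ext {true} f g = sym (f refl)
bool-ext {false} {true} f g = g refl
bool-ext {false} {false} f g = refl

private variable A B : Set

toℕ : Bool → ℕ
toℕ true = 1
toℕ false = 0

∑ : List A → (A → ℕ) → ℕ
∑ [] f = 0
∑ (x ∷ xs) f = f x ℕ.+ ∑ xs f

syntax ∑ xs (λ x → e) = ∑[ x ∈ xs ] e

_⇒ᵇ_ : (A → Bool) → (A → Bool) → Set
r ⇒ᵇ p = ∀ x → r x ≡ true → p x ≡ true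


any-true⁺ : (p : A → Bool) {xs : List A} {x : A} → x ∈ xs → p x ≡ true → any p xs ≡ true
any-true⁺ p x∈xs px = Equivalence.to Boolₚ.T-≡ (any⁺ p (lose x∈xs (Equivalence.from Boolₚ.T-≡ px)))

any-true⁻ : (p : A → Bool) (xs : List A) → any p xs ≡ true → ∃ λ x → x ∈ xs × p x ≡ true
any-true⁻ p xs h with find (any⁻ p xs (Equivalence.from Boolₚ.T-≡ h))
... | x , x∈xs , px = x , x∈xs , Equivalence.to Boolₚ.T-≡ px

∑-cong : (f g : A → ℕ) (xs : List A) → (∀ x → x ∈ xs → f x ≡ g x) → ∑ xs f ≡ ∑ xs g
∑-cong f g [] h = refl
∑-cong f g (x ∷ xs) h = cong₂ ℕ._+_ (h x (here refl)) (∑-cong f g xs (λ y m → h y (there m)))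

∑-+ : (f g : A → ℕ) (xs : List A) → ∑[ x ∈ xs ] (f x ℕ.+ g x) ≡ ∑ xs f ℕ.+ ∑ xs g
∑-+ f g [] = refl
∑-+ f g (x ∷ xs) rewrite ∑-+ f g xs = CommutativeSemigroupₚ.interchange ℕₚ.+-commutativeSemigroup (f x) (g x) (∑ xs f) (∑ xs g)

∑-*ˡ : (c : ℕ) (f : A → ℕ) (xs : List A) → ∑[ x ∈ xs ] (c ℕ.* f x) ≡ c ℕ.* ∑ xs f
∑-*ˡ c f [] = sym (ℕₚ.*-zeroʳ c)
∑-*ˡ c f (x ∷ xs) rewrite ∑-*ˡ c f xs = sym (ℕₚ.*-distribˡ-+ c (f x) (∑ xs f))

∑-1 : (xs : List A) → ∑[ _ ∈ xs ] 1 ≡ length xs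
∑-1 [] = refl
∑-1 (_ ∷ xs) = cong suc (∑-1 xs)

∑-0 : (xs : List A) → ∑[ _ ∈ xs ] 0 ≡ 0
∑-0 [] = refl
∑-0 (_ ∷ xs) = ∑-0 xs

∑-comm : (f : A → B → ℕ) (xs : List A) (ys : List B) →
  ∑[ x ∈ xs ] ∑[ y ∈ ys ] f x y ≡ ∑[ y ∈ ys ] ∑[ x ∈ xs ] f x y
∑-comm f [] ys = sym (∑-0 ys)
∑-comm f (x ∷ xs) ys rewrite ∑-comm f xs ys = sym (∑-+ (f x) (λ y → ∑[ x' ∈ xs ] f x' y) ys)

xor-parity : ∀ a b c → ∃ λ k → toℕ (b xor c) ℕ.+ (toℕ (a xor b) ℕ.+ toℕ (a xor c)) ≡ k ℕ.+ k
xor-parity true true true = 0 , refl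
xor-parity true true false = 1 , refl
xor-parity true false true = 1 , refl
xor-parity true false false = 1 , refl
xor-parity false true true = 1 , refl
xor-parity false true false = 1 , refl
xor-parity false false true = 1 , refl
xor-parity false false false = 0 , refl

even-sum⇒2∣difference : ∀ a b k → a ℕ.+ b ≡ k ℕ.+ k → (+ 2) ∣ (+ a - + b)
even-sum⇒2∣difference a b k a+b≡2k = ∣⇒∣ᵤ (divides (+ k - + b) (begin
  + a - + b                        ≡⟨ shift (+ a) (+ b) ⟩
  + (a ℕ.+ b) - (+ b ℤ.+ + b)      ≡⟨ cong (λ n → + n - (+ b ℤ.+ + b)) a+b≡2k ⟩
  + (k ℕ.+ k) - (+ b ℤ.+ + b)      ≡⟨ halve (+ k) (+ b) ⟩
  (+ k - + b) ℤ.* + 2              ∎))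
  where
  open ≡-Reasoning
  shift : ∀ i j → i - j ≡ (i ℤ.+ j) - (j ℤ.+ j)
  shift = ℤSolver.solve-∀
  halve : ∀ i j → (i ℤ.+ i) - (j ℤ.+ j) ≡ (i - j) ℤ.* + 2
  halve = ℤSolver.solve-∀

module Counting (F : FiniteField) where
  open PG2 F using (count)

  count≡∑ : (p : A → Bool) (xs : List A) → count p xs ≡ ∑[ x ∈ xs ] toℕ (p x)
  count≡∑ p [] = refl
  count≡∑ p (x ∷ xs) with p x
  ... | true = cong suc (count≡∑ p xs)
  ... | false = count≡∑ p xs

  count-cong : (p r : A → Bool) (xs : List A) → (∀ x → x ∈ xs → p x ≡ r x) → count p xs ≡ count r xs
  count-cong p r xs h = trans (count≡∑ p xs) (trans (∑-cong _ _ xs (λ x m → cong toℕ (h x m))) (sym (count≡∑ r xs)))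

  count-const-false : (xs : List A) → count (λ _ → false) xs ≡ 0
  count-const-false [] = refl
  count-const-false (_ ∷ xs) = count-const-false xs

  count+count-not : (p : A → Bool) (xs : List A) → count p xs ℕ.+ count (λ x → not (p x)) xs ≡ length xs
  count+count-not p [] = refl
  count+count-not p (x ∷ xs) with p x
  ... | true = cong suc (count+count-not p xs)
  ... | false = trans (ℕₚ.+-suc _ _) (cong suc (count+count-not p xs))

  count≡0⇒false : (p : A → Bool) (xs : List A) → count p xs ≡ 0 → ∀ x → x ∈ xs → p x ≡ false
  count≡0⇒false p (y ∷ xs) c x m with p y in eq
  count≡0⇒false p (y ∷ xs) () x m | true
  count≡0⇒false p (y ∷ xs) c x (here refl) | false = eq
  count≡0⇒false p (y ∷ xs) c x (there m) | false = count≡0⇒false p xs c x m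

  count-mono : (p r : A → Bool) (xs : List A) → r ⇒ᵇ p → count r xs ℕ.≤ count p xs
  count-mono p r [] h = ℕ.z≤n
  count-mono p r (x ∷ xs) h with r x in er | p x in ep
  ... | true | true = ℕ.s≤s (count-mono p r xs h)
  ... | true | false with () ← trans (sym (h x er)) ep
  ... | false | true = ℕₚ.m≤n⇒m≤1+n (count-mono p r xs h)
  ... | false | false = count-mono p r xs h

  count≡0-mono : (p r : A → Bool) (xs : List A) → r ⇒ᵇ p → count p xs ≡ 0 → count r xs ≡ 0
  count≡0-mono p r xs h c = ℕₚ.n≤0⇒n≡0 (subst (count r xs ℕ.≤_) c (count-mono p r xs h))

  count-≡⇒⇐ : (p r : A → Bool) (xs : List A) → r ⇒ᵇ p → count r xs ≡ count p xs →
              ∀ x → x ∈ xs → p x ≡ true → r x ≡ true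
  count-≡⇒⇐ p r (y ∷ xs) h c x m px with r y in er | p y in ep
  ... | true | false with () ← trans (sym (h y er)) ep
  count-≡⇒⇐ p r (y ∷ xs) h c x (here refl) px | true | true = er
  count-≡⇒⇐ p r (y ∷ xs) h c x (there m) px | true | true = count-≡⇒⇐ p r xs h (ℕₚ.suc-injective c) x m px
  count-≡⇒⇐ p r (y ∷ xs) h c x m px | false | true =
    ⊥-elim (ℕₚ.<⇒≱ (ℕ.s≤s (count-mono p r xs h)) (ℕₚ.≤-reflexive (sym c)))
  count-≡⇒⇐ p r (y ∷ xs) h c x (here refl) px | false | false with () ← trans (sym px) ep
  count-≡⇒⇐ p r (y ∷ xs) h c x (there m) px | false | false = count-≡⇒⇐ p r xs h c x m px

  record OneWitness (p : A → Bool) (xs : List A) : Set where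
    field
      elem : A
      elem∈ : elem ∈ xs
      p-elem : p elem ≡ true
      only : ∀ z → z ∈ xs → p z ≡ true → z ≡ elem
      count-below : ∀ r → r ⇒ᵇ p → count r xs ≡ toℕ (r elem)

  record TwoWitnesses (p : A → Bool) (xs : List A) : Set where
    field
      first second : A
      first∈ : first ∈ xs
      second∈ : second ∈ xs
      p-first : p first ≡ true
      p-second : p second ≡ true
      distinct : Unique xs → first ≢ second
      only : ∀ z → z ∈ xs → p z ≡ true → z ≡ first ⊎ z ≡ second
      count-below : ∀ r → r ⇒ᵇ p → count r xs ≡ toℕ (r first) ℕ.+ toℕ (r second)

  count≡1⇒witness : (p : A → Bool) (xs : List A) → count p xs ≡ 1 → OneWitness p xs
  count≡1⇒witness p (x ∷ xs) c with p x in px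
  ... | true = record { elem = x ; elem∈ = here refl ; p-elem = px ; only = only ; count-below = below }
    where
    rest≡0 : count p xs ≡ 0
    rest≡0 = ℕₚ.suc-injective c
    only : ∀ z → z ∈ x ∷ xs → p z ≡ true → z ≡ x
    only z (here refl) pz = refl
    only z (there z∈) pz with () ← trans (sym pz) (count≡0⇒false p xs rest≡0 z z∈)
    below : ∀ r → r ⇒ᵇ p → count r (x ∷ xs) ≡ toℕ (r x)
    below r r⇒p with r x
    ... | true = cong suc (count≡0-mono p r xs r⇒p rest≡0)
    ... | false = count≡0-mono p r xs r⇒p rest≡0
  ... | false = record { elem = W.elem ; elem∈ = there W.elem∈ ; p-elem = W.p-elem ; only = only ; count-below = below }
    where
    module W = OneWitness (count≡1⇒witness p xs c)
    only : ∀ z → z ∈ x ∷ xs → p z ≡ true → z ≡ W.elem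
    only z (here refl) pz with () ← trans (sym pz) px
    only z (there z∈) pz = W.only z z∈ pz
    below : ∀ r → r ⇒ᵇ p → count r (x ∷ xs) ≡ toℕ (r W.elem)
    below r r⇒p with r x in rx
    ... | true with () ← trans (sym (r⇒p x rx)) px
    below r r⇒p | false = W.count-below r r⇒p

  count≡2⇒witnesses : (p : A → Bool) (xs : List A) → count p xs ≡ 2 → TwoWitnesses p xs
  count≡2⇒witnesses p (x ∷ xs) c with p x in px
  ... | true = record
    { first = x ; second = W.elem ; first∈ = here refl ; second∈ = there W.elem∈ ; p-first = px ; p-second = W.p-elem
    ; distinct = distinct ; only = only ; count-below = below }
    where
    module W = OneWitness (count≡1⇒witness p xs (ℕₚ.suc-injective c))
    distinct : Unique (x ∷ xs) → x ≢ W.elem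
    distinct (x∉ ∷ _) = All.lookup x∉ W.elem∈
    only : ∀ z → z ∈ x ∷ xs → p z ≡ true → z ≡ x ⊎ z ≡ W.elem
    only z (here refl) pz = inj₁ refl
    only z (there z∈) pz = inj₂ (W.only z z∈ pz)
    below : ∀ r → r ⇒ᵇ p → count r (x ∷ xs) ≡ toℕ (r x) ℕ.+ toℕ (r W.elem)
    below r r⇒p with r x
    ... | true = cong suc (W.count-below r r⇒p)
    ... | false = W.count-below r r⇒p
  ... | false = record
    { first = W.first ; second = W.second ; first∈ = there W.first∈ ; second∈ = there W.second∈
    ; p-first = W.p-first ; p-second = W.p-second
    ; distinct = λ { (_ ∷ u) → W.distinct u } ; only = only ; count-below = below }
    where
    module W = TwoWitnesses (count≡2⇒witnesses p xs c)
    only : ∀ z → z ∈ x ∷ xs → p z ≡ true → z ≡ W.first ⊎ z ≡ W.second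
    only z (here refl) pz with () ← trans (sym pz) px
    only z (there z∈) pz = W.only z z∈ pz
    below : ∀ r → r ⇒ᵇ p → count r (x ∷ xs) ≡ toℕ (r W.first) ℕ.+ toℕ (r W.second)
    below r r⇒p with r x in rx
    ... | true with () ← trans (sym (r⇒p x rx)) px
    below r r⇒p | false = W.count-below r r⇒p

  module BooleanEquality {A : Set} (_==_ : A → A → Bool)
    (==-refl : ∀ x → (x == x) ≡ true) (==-sound : ∀ x y → (x == y) ≡ true → x ≡ y) where
    open ≡-Reasoning

    ==-complete : ∀ x y → x ≢ y → (x == y) ≡ false
    ==-complete x y x≢y with x == y in eq
    ... | true = ⊥-elim (x≢y (==-sound x y eq))
    ... | false = refl

    ==-cong : ∀ {x y u v} → (x ≡ y → u ≡ v) → (u ≡ v → x ≡ y) → (x == y) ≡ (u == v)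
    ==-cong {x} {y} {u} {v} f g with x == y in e₁ | u == v in e₂
    ... | true | true = refl
    ... | false | false = refl
    ... | true | false with refl ← f (==-sound x y e₁) with () ← trans (sym (==-refl u)) e₂
    ... | false | true with refl ← g (==-sound u v e₂) with () ← trans (sym (==-refl x)) e₁

    ∑-select : (g : A → ℕ) (z : A) (xs : List A) → Unique xs → z ∈ xs → ∑[ y ∈ xs ] (g y ℕ.* toℕ (z == y)) ≡ g z
    ∑-select g z (y ∷ xs) (z∉ ∷ _) (here refl)
      rewrite ==-refl z | ℕₚ.*-identityʳ (g z) = trans (cong (g z ℕ.+_) (∑-absent xs z∉)) (ℕₚ.+-identityʳ (g z))
      where
      ∑-absent : ∀ ys → All (z ≢_) ys → ∑[ y ∈ ys ] (g y ℕ.* toℕ (z == y)) ≡ 0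
      ∑-absent [] [] = refl
      ∑-absent (y ∷ ys) (z≢y ∷ a) rewrite ==-complete z y z≢y | ℕₚ.*-zeroʳ (g y) = ∑-absent ys a
    ∑-select g z (y ∷ xs) (y∉ ∷ u) (there z∈)
      rewrite ==-complete z y (λ z≡y → All.lookup y∉ z∈ (sym z≡y)) | ℕₚ.*-zeroʳ (g y) = ∑-select g z xs u z∈

    ∑-==≡1 : (z : A) (xs : List A) → Unique xs → z ∈ xs → ∑[ y ∈ xs ] toℕ (z == y) ≡ 1
    ∑-==≡1 z xs u z∈ = trans (∑-cong _ _ xs (λ y _ → sym (ℕₚ.*-identityˡ (toℕ (z == y))))) (∑-select (λ _ → 1) z xs u z∈)

    count≡2 : (p : A → Bool) (xs : List A) → Unique xs → (x y : A) → x ≢ y → x ∈ xs → y ∈ xs →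
      p x ≡ true → p y ≡ true → (∀ z → z ∈ xs → p z ≡ true → z ≡ x ⊎ z ≡ y) → count p xs ≡ 2
    count≡2 p xs u x y x≢y x∈ y∈ px py only = begin
        count p xs                                              ≡⟨ count≡∑ p xs ⟩
        ∑[ z ∈ xs ] toℕ (p z)                                   ≡⟨ ∑-cong _ _ xs split ⟩
        ∑[ z ∈ xs ] (toℕ (x == z) ℕ.+ toℕ (y == z))            ≡⟨ ∑-+ _ _ xs ⟩
        ∑[ z ∈ xs ] toℕ (x == z) ℕ.+ ∑[ z ∈ xs ] toℕ (y == z)  ≡⟨ cong₂ ℕ._+_ (∑-==≡1 x xs u x∈) (∑-==≡1 y xs u y∈) ⟩
        2                                                       ∎
      where
      split : ∀ z → z ∈ xs → toℕ (p z) ≡ toℕ (x == z) ℕ.+ toℕ (y == z)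
      split z z∈ with p z in pz
      ... | true with only z z∈ pz
      ...   | inj₁ refl rewrite ==-refl z | ==-complete y z (λ e → x≢y (sym e)) = refl
      ...   | inj₂ refl rewrite ==-refl z | ==-complete x z x≢y = refl
      split z z∈ | false with x == z in ex | y == z in ey
      ... | false | false = refl
      ... | true | _ with refl ← ==-sound x z ex with () ← trans (sym px) pz
      split z z∈ | false | false | true with refl ← ==-sound y z ey with () ← trans (sym py) pz

    module OnEnumeration (es : List A) (unique : Unique es) (complete : ∀ x → x ∈ es) where

      count-∘-bijection : (p : A → Bool) (σ τ : A → A) → (∀ y → σ (τ y) ≡ y) → (∀ x → τ (σ x) ≡ x) →
                          count (λ x → p (σ x)) es ≡ count p es
      count-∘-bijection p σ τ στ τσ = begin
          count (λ x → p (σ x)) es                                    ≡⟨ count≡∑ _ es ⟩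
          ∑[ x ∈ es ] toℕ (p (σ x))                                   ≡⟨ ∑-cong _ _ es (λ x _ → sym (∑-select (λ y → toℕ (p y)) (σ x) es unique (complete (σ x)))) ⟩
          ∑[ x ∈ es ] ∑[ y ∈ es ] (toℕ (p y) ℕ.* toℕ (σ x == y))     ≡⟨ ∑-comm (λ x y → toℕ (p y) ℕ.* toℕ (σ x == y)) es es ⟩
          ∑[ y ∈ es ] ∑[ x ∈ es ] (toℕ (p y) ℕ.* toℕ (σ x == y))     ≡⟨ ∑-cong _ _ es (λ y _ → ∑-*ˡ (toℕ (p y)) (λ x → toℕ (σ x == y)) es) ⟩
          ∑[ y ∈ es ] (toℕ (p y) ℕ.* ∑[ x ∈ es ] toℕ (σ x == y))     ≡⟨ ∑-cong _ _ es (λ y _ → cong (toℕ (p y) ℕ.*_) (preimage y)) ⟩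
          ∑[ y ∈ es ] (toℕ (p y) ℕ.* 1)                               ≡⟨ ∑-cong _ _ es (λ y _ → ℕₚ.*-identityʳ (toℕ (p y))) ⟩
          ∑[ y ∈ es ] toℕ (p y)                                       ≡⟨ count≡∑ p es ⟨
          count p es                                                  ∎
        where
        preimage : ∀ y → ∑[ x ∈ es ] toℕ (σ x == y) ≡ 1
        preimage y = trans (∑-cong _ _ es (λ x _ → cong toℕ (==-cong (λ { refl → τσ x }) (λ { refl → στ y }))))
                           (∑-==≡1 (τ y) es unique (complete (τ y)))

module Field (F : FiniteField) where
  open FiniteField F public using (Carrier; _+_; _*_; -_; 0#; 1#; _≟_; elements; elements-complete; elements-unique; inverse; 0≢1; order)
  open PG2 F using (eqᵇ)
  open Counting F

  commutativeRing : CommutativeRing _ _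
  commutativeRing = record { isCommutativeRing = FiniteField.isCommutativeRing F }

  open CommutativeRing commutativeRing public
    using (+-assoc; +-comm; *-assoc; *-comm; +-identityˡ; +-identityʳ; *-identityˡ; *-identityʳ; zeroˡ; zeroʳ; distribʳ; -‿inverseʳ)
  open RingProperties (CommutativeRing.ring commutativeRing) public using (-0#≈0#; -‿involutive; -‿distribˡ-*; -‿distribʳ-*; -‿+-comm)
  open CommutativeSemigroupₚ (CommutativeRing.+-commutativeSemigroup commutativeRing) using () renaming (interchange to +-interchange)
  open ≡-Reasoning

  infixl 6 _−_
  _−_ : Carrier → Carrier → Carrier
  x − y = x + - y

  fromℕ : ℕ → Carrier
  fromℕ zero = 0#
  fromℕ (suc n) = 1# + fromℕ n

  fromℤ : ℤ → Carrier
  fromℤ (+ n) = fromℕ n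
  fromℤ ℤ.-[1+ n ] = - fromℕ (suc n)

  fromℕ-+ : ∀ m n → fromℕ (m ℕ.+ n) ≡ fromℕ m + fromℕ n
  fromℕ-+ zero n = sym (+-identityˡ (fromℕ n))
  fromℕ-+ (suc m) n = trans (cong (λ z → 1# + z) (fromℕ-+ m n)) (sym (+-assoc 1# (fromℕ m) (fromℕ n)))

  fromℕ-* : ∀ m n → fromℕ (m ℕ.* n) ≡ fromℕ m * fromℕ n
  fromℕ-* zero n = sym (zeroˡ (fromℕ n))
  fromℕ-* (suc m) n = begin
    fromℕ (n ℕ.+ m ℕ.* n)            ≡⟨ fromℕ-+ n (m ℕ.* n) ⟩
    fromℕ n + fromℕ (m ℕ.* n)        ≡⟨ cong₂ _+_ (sym (*-identityˡ (fromℕ n))) (fromℕ-* m n) ⟩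
    1# * fromℕ n + fromℕ m * fromℕ n ≡⟨ distribʳ (fromℕ n) 1# (fromℕ m) ⟨
    (1# + fromℕ m) * fromℕ n         ∎

  fromℤ-⊖ : ∀ m n → fromℤ (m ℤ.⊖ n) ≡ fromℕ m − fromℕ n
  fromℤ-⊖ zero zero = sym (trans (+-identityˡ _) -0#≈0#)
  fromℤ-⊖ zero (suc n) = sym (+-identityˡ _)
  fromℤ-⊖ (suc m) zero = sym (trans (cong (λ z → fromℕ (suc m) + z) -0#≈0#) (+-identityʳ _))
  fromℤ-⊖ (suc m) (suc n) rewrite ℤₚ.[1+m]⊖[1+n]≡m⊖n m n = begin
    fromℤ (m ℤ.⊖ n)                     ≡⟨ fromℤ-⊖ m n ⟩
    fromℕ m − fromℕ n                   ≡⟨ +-identityˡ _ ⟨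
    0# + (fromℕ m − fromℕ n)            ≡⟨ cong (_+ (fromℕ m − fromℕ n)) (-‿inverseʳ 1#) ⟨
    (1# − 1#) + (fromℕ m − fromℕ n)     ≡⟨ +-interchange 1# (- 1#) (fromℕ m) (- fromℕ n) ⟩
    (1# + fromℕ m) + (- 1# − fromℕ n)   ≡⟨ cong (λ z → (1# + fromℕ m) + z) (-‿+-comm 1# (fromℕ n)) ⟩
    (1# + fromℕ m) − (1# + fromℕ n)     ∎

  fromℤ-neg : ∀ i → fromℤ (ℤ.- i) ≡ - fromℤ i
  fromℤ-neg (+ zero) = sym -0#≈0#
  fromℤ-neg (+ suc n) = refl
  fromℤ-neg ℤ.-[1+ n ] = sym (-‿involutive _)

  fromℤ-+ : ∀ i j → fromℤ (i ℤ.+ j) ≡ fromℤ i + fromℤ j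
  fromℤ-+ ℤ.-[1+ m ] ℤ.-[1+ n ] = begin
    - fromℕ (suc (suc (m ℕ.+ n)))          ≡⟨ cong (λ k → - fromℕ (suc k)) (ℕₚ.+-suc m n) ⟨
    - fromℕ (suc m ℕ.+ suc n)              ≡⟨ cong -_ (fromℕ-+ (suc m) (suc n)) ⟩
    - (fromℕ (suc m) + fromℕ (suc n))      ≡⟨ -‿+-comm _ _ ⟨
    - fromℕ (suc m) + - fromℕ (suc n)      ∎
  fromℤ-+ ℤ.-[1+ m ] (+ n) = trans (fromℤ-⊖ n (suc m)) (+-comm _ _)
  fromℤ-+ (+ m) ℤ.-[1+ n ] = fromℤ-⊖ m (suc n)
  fromℤ-+ (+ m) (+ n) = fromℕ-+ m n

  fromℤ-* : ∀ i j → fromℤ (i ℤ.* j) ≡ fromℤ i * fromℤ j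
  fromℤ-* (+ m) (+ n) rewrite ℤₚ.+◃n≡+n (m ℕ.* n) = fromℕ-* m n
  fromℤ-* (+ m) ℤ.-[1+ n ] rewrite ℤₚ.-◃n≡-n (m ℕ.* suc n) =
    trans (fromℤ-neg (+ (m ℕ.* suc n))) (trans (cong -_ (fromℕ-* m (suc n))) (-‿distribʳ-* _ _))
  fromℤ-* ℤ.-[1+ m ] (+ n) rewrite ℤₚ.-◃n≡-n (suc m ℕ.* n) =
    trans (fromℤ-neg (+ (suc m ℕ.* n))) (trans (cong -_ (fromℕ-* (suc m) n)) (-‿distribˡ-* _ _))
  fromℤ-* ℤ.-[1+ m ] ℤ.-[1+ n ] rewrite ℤₚ.+◃n≡+n (suc m ℕ.* suc n) = begin
    fromℕ (suc m ℕ.* suc n) ≡⟨ fromℕ-* (suc m) (suc n) ⟩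
    a * b                   ≡⟨ -‿involutive _ ⟨
    - - (a * b)             ≡⟨ cong -_ (-‿distribʳ-* a b) ⟩
    - (a * - b)             ≡⟨ -‿distribˡ-* a (- b) ⟩
    - a * - b               ∎
    where a = fromℕ (suc m) ; b = fromℕ (suc n)

  -- Integer constants in solver expressions denote their images under fromℤ.
  fromℤ-homomorphism : ℤ.+-*-rawRing ACR.-Raw-AlmostCommutative⟶ ACR.fromCommutativeRing commutativeRing
  fromℤ-homomorphism = record
    { ⟦_⟧ = fromℤ ; +-homo = fromℤ-+ ; *-homo = fromℤ-* ; -‿homo = fromℤ-neg
    ; 0-homo = refl ; 1-homo = +-identityʳ 1# }

  open RingSolver ℤ.+-*-rawRing (ACR.fromCommutativeRing commutativeRing) fromℤ-homomorphism
    (λ i j → Maybe.map (cong fromℤ) (dec⇒maybe (i ℤₚ.≟ j)))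
    public using (solve; _:=_; _:+_; _:*_; :-_; _:-_; con)

  two four : Carrier
  two = fromℕ 2
  four = fromℕ 4

  eqᵇ-refl : ∀ x → eqᵇ x x ≡ true
  eqᵇ-refl x with x ≟ x
  ... | yes _ = refl
  ... | no x≢x = ⊥-elim (x≢x refl)

  eqᵇ-sound : ∀ x y → eqᵇ x y ≡ true → x ≡ y
  eqᵇ-sound x y h with x ≟ y
  ... | yes x≡y = x≡y

  open BooleanEquality eqᵇ eqᵇ-refl eqᵇ-sound public
    using () renaming (==-complete to eqᵇ-complete; ==-cong to eqᵇ-cong)
  module ElementCounting = BooleanEquality eqᵇ eqᵇ-refl eqᵇ-sound
  open ElementCounting.OnEnumeration elements elements-unique elements-complete public using (count-∘-bijection)

  1≢0 : 1# ≢ 0#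
  1≢0 e = 0≢1 (sym e)

  x−y≡0⇒x≡y : ∀ x y → x − y ≡ 0# → x ≡ y
  x−y≡0⇒x≡y x y h = begin
    x             ≡⟨ solve 2 (λ x y → x := (x :- y) :+ y) refl x y ⟩
    (x − y) + y   ≡⟨ cong (_+ y) h ⟩
    0# + y        ≡⟨ +-identityˡ y ⟩
    y             ∎

  x+y≡0⇒x≡-y : ∀ x y → x + y ≡ 0# → x ≡ - y
  x+y≡0⇒x≡-y x y h = begin
    x             ≡⟨ solve 2 (λ x y → x := (x :+ y) :- y) refl x y ⟩
    (x + y) − y   ≡⟨ cong (_− y) h ⟩
    0# − y        ≡⟨ +-identityˡ (- y) ⟩
    - y           ∎

  inv : (x : Carrier) → x ≢ 0# → Carrier
  inv x x≢0 = proj₁ (inverse x x≢0)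

  inv-inverseʳ : ∀ x (x≢0 : x ≢ 0#) → x * inv x x≢0 ≡ 1#
  inv-inverseʳ x x≢0 = proj₂ (inverse x x≢0)

  inv-inverseˡ : ∀ x (x≢0 : x ≢ 0#) → inv x x≢0 * x ≡ 1#
  inv-inverseˡ x x≢0 = trans (*-comm _ x) (inv-inverseʳ x x≢0)

  inv≢0 : ∀ x (x≢0 : x ≢ 0#) → inv x x≢0 ≢ 0#
  inv≢0 x x≢0 h = 1≢0 (trans (sym (inv-inverseʳ x x≢0)) (trans (cong (x *_) h) (zeroʳ x)))

  x⁻¹*[x*y]≡y : ∀ x (x≢0 : x ≢ 0#) y → inv x x≢0 * (x * y) ≡ y
  x⁻¹*[x*y]≡y x x≢0 y = trans (sym (*-assoc _ x y)) (trans (cong (_* y) (inv-inverseˡ x x≢0)) (*-identityˡ y))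

  x*[x⁻¹*y]≡y : ∀ x (x≢0 : x ≢ 0#) y → x * (inv x x≢0 * y) ≡ y
  x*[x⁻¹*y]≡y x x≢0 y = trans (sym (*-assoc x _ y)) (trans (cong (_* y) (inv-inverseʳ x x≢0)) (*-identityˡ y))

  [y*x]*x⁻¹≡y : ∀ x (x≢0 : x ≢ 0#) y → (y * x) * inv x x≢0 ≡ y
  [y*x]*x⁻¹≡y x x≢0 y = trans (*-assoc y x _) (trans (cong (y *_) (inv-inverseʳ x x≢0)) (*-identityʳ y))

  [y*x⁻¹]*x≡y : ∀ x (x≢0 : x ≢ 0#) y → (y * inv x x≢0) * x ≡ y
  [y*x⁻¹]*x≡y x x≢0 y = trans (*-assoc y _ x) (trans (cong (y *_) (inv-inverseˡ x x≢0)) (*-identityʳ y))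

  *-cancelˡ : ∀ c a b → c ≢ 0# → c * a ≡ c * b → a ≡ b
  *-cancelˡ c a b c≢0 h = trans (sym (x⁻¹*[x*y]≡y c c≢0 a)) (trans (cong (inv c c≢0 *_) h) (x⁻¹*[x*y]≡y c c≢0 b))

  x*y≡0 : ∀ x y → x * y ≡ 0# → x ≡ 0# ⊎ y ≡ 0#
  x*y≡0 x y h with x ≟ 0#
  ... | yes x≡0 = inj₁ x≡0
  ... | no x≢0 = inj₂ (*-cancelˡ x y 0# x≢0 (trans h (sym (zeroʳ x))))

  x*y≢0 : ∀ x y → x ≢ 0# → y ≢ 0# → x * y ≢ 0#
  x*y≢0 x y x≢0 y≢0 h with x*y≡0 x y h
  ... | inj₁ x≡0 = x≢0 x≡0
  ... | inj₂ y≡0 = y≢0 y≡0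

  x*x≡0⇒x≡0 : ∀ x → x * x ≡ 0# → x ≡ 0#
  x*x≡0⇒x≡0 x h with x*y≡0 x x h
  ... | inj₁ e = e
  ... | inj₂ e = e

module OddOrder (F : FiniteField) (odd : FiniteField.order F % 2 ≡ 1) where
  open Field F
  open PG2 F using (count; eqᵇ)
  open Counting F
  open ≡-Reasoning

  position : Carrier → List Carrier → ℕ
  position x [] = 0
  position x (y ∷ ys) = if eqᵇ x y then 0 else suc (position x ys)

  position-injective : ∀ {x y} ys → x ∈ ys → y ∈ ys → position x ys ≡ position y ys → x ≡ y
  position-injective {x} {y} (z ∷ ys) x∈ y∈ h with x ≟ z | y ≟ z
  ... | yes x≡z | yes y≡z = trans x≡z (sym y≡z)
  ... | no x≢z | no y≢z = position-injective ys (tail x≢z x∈) (tail y≢z y∈) (ℕₚ.suc-injective h)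
    where
    tail : ∀ {w} → w ≢ z → w ∈ z ∷ ys → w ∈ ys
    tail w≢z (here w≡z) = ⊥-elim (w≢z w≡z)
    tail w≢z (there w∈) = w∈
  position-injective (z ∷ ys) x∈ y∈ () | yes _ | no _
  position-injective (z ∷ ys) x∈ y∈ () | no _ | yes _

  <ᵇ-flip : ∀ a b → a ≢ b → not (a <ᵇ b) ≡ (b <ᵇ a)
  <ᵇ-flip zero zero a≢b = ⊥-elim (a≢b refl)
  <ᵇ-flip zero (suc b) a≢b = refl
  <ᵇ-flip (suc a) zero a≢b = refl
  <ᵇ-flip (suc a) (suc b) a≢b = <ᵇ-flip a b (λ e → a≢b (cong suc e))

  -- If 1 + 1 = 0 then x ↦ x + 1 is a fixed-point-free involution, and exactly one element
  -- of each orbit {x, x + 1} comes first in the enumeration, so the order would be even.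
  two≢0 : two ≢ 0#
  two≢0 two≡0 = even≢odd (trans (sym (DivMod.m*n%n≡0 (count first elements) 2)) (trans (cong (_% 2) twice-first≡order) odd))
    where
    even≢odd : 0 ≢ 1
    even≢odd ()
    1+1≡0 : 1# + 1# ≡ 0#
    1+1≡0 = trans (cong (λ z → 1# + z) (sym (+-identityʳ 1#))) two≡0
    σ : Carrier → Carrier
    σ x = x + 1#
    σ-involutive : ∀ x → σ (σ x) ≡ x
    σ-involutive x = trans (+-assoc x 1# 1#) (trans (cong (λ z → x + z) 1+1≡0) (+-identityʳ x))
    σx≢x : ∀ x → σ x ≢ x
    σx≢x x σx≡x = 1≢0 (begin
      1#             ≡⟨ solve 2 (λ x o → o := (x :+ o) :- x) refl x 1# ⟩
      σ x − x        ≡⟨ cong (_− x) σx≡x ⟩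
      x − x          ≡⟨ -‿inverseʳ x ⟩
      0#             ∎)
    first : Carrier → Bool
    first x = position x elements <ᵇ position (σ x) elements
    not-first : ∀ x → not (first x) ≡ first (σ x)
    not-first x = trans
      (<ᵇ-flip _ _ (λ e → σx≢x x (sym (position-injective elements (elements-complete x) (elements-complete (σ x)) e))))
      (cong (λ z → position (σ x) elements <ᵇ position z elements) (sym (σ-involutive x)))
    twice-first≡order : count first elements ℕ.* 2 ≡ order
    twice-first≡order = begin
      count first elements ℕ.* 2                                        ≡⟨ ℕₚ.*-comm (count first elements) 2 ⟩
      count first elements ℕ.+ (count first elements ℕ.+ 0)             ≡⟨ cong (count first elements ℕ.+_) (ℕₚ.+-identityʳ _) ⟩
      count first elements ℕ.+ count first elements                     ≡⟨ cong (count first elements ℕ.+_) (count-∘-bijection first σ σ σ-involutive σ-involutive) ⟨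
      count first elements ℕ.+ count (λ x → first (σ x)) elements       ≡⟨ cong (count first elements ℕ.+_) (count-cong _ _ elements (λ x _ → sym (not-first x))) ⟩
      count first elements ℕ.+ count (λ x → not (first x)) elements     ≡⟨ count+count-not first elements ⟩
      order                                                             ∎

  four≡two*two : four ≡ two * two
  four≡two*two = solve 0 (con (+ 4) := con (+ 2) :* con (+ 2)) refl

  four≢0 : four ≢ 0#
  four≢0 h = x*y≢0 two two two≢0 two≢0 (trans (sym four≡two*two) h)

module Squares (F : FiniteField) (odd : FiniteField.order F % 2 ≡ 1) where
  open Field F
  open OddOrder F odd
  open PG2 F using (count; eqᵇ)
  open Counting F
  open ≡-Reasoning

  isSquare : Carrier → Bool
  isSquare d = any (λ r → eqᵇ (r * r) d) elements

  isSquare-intro : ∀ r d → r * r ≡ d → isSquare d ≡ true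
  isSquare-intro r d r²≡d = any-true⁺ _ (elements-complete r) (subst (λ z → eqᵇ z d ≡ true) (sym r²≡d) (eqᵇ-refl d))

  isSquare-elim : ∀ d → isSquare d ≡ true → ∃ λ r → r * r ≡ d
  isSquare-elim d h with any-true⁻ _ elements h
  ... | r , _ , e = r , eqᵇ-sound _ _ e

  isSquare-0 : isSquare 0# ≡ true
  isSquare-0 = isSquare-intro 0# 0# (zeroˡ 0#)

  nonsquare≢0 : ∀ d → isSquare d ≡ false → d ≢ 0#
  nonsquare≢0 d h refl with () ← trans (sym isSquare-0) h

  isSquare-*-square : ∀ k d → k ≢ 0# → isSquare ((k * k) * d) ≡ isSquare d
  isSquare-*-square k d k≢0 = bool-ext from to
    where
    from : isSquare ((k * k) * d) ≡ true → isSquare d ≡ true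
    from h with isSquare-elim _ h
    ... | r , r²≡k²d = isSquare-intro (r * inv k k≢0) d (begin
      (r * inv k k≢0) * (r * inv k k≢0)  ≡⟨ solve 2 (λ r i → (r :* i) :* (r :* i) := (r :* r) :* (i :* i)) refl r (inv k k≢0) ⟩
      (r * r) * (inv k k≢0 * inv k k≢0)  ≡⟨ cong (_* (inv k k≢0 * inv k k≢0)) r²≡k²d ⟩
      ((k * k) * d) * (inv k k≢0 * inv k k≢0) ≡⟨ solve 3 (λ k d i → ((k :* k) :* d) :* (i :* i) := ((k :* i) :* (k :* i)) :* d) refl k d (inv k k≢0) ⟩
      ((k * inv k k≢0) * (k * inv k k≢0)) * d ≡⟨ cong (λ z → (z * z) * d) (inv-inverseʳ k k≢0) ⟩
      (1# * 1#) * d                      ≡⟨ trans (cong (_* d) (*-identityˡ 1#)) (*-identityˡ d) ⟩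
      d                                  ∎)
    to : isSquare d ≡ true → isSquare ((k * k) * d) ≡ true
    to h with isSquare-elim _ h
    ... | r , r²≡d = isSquare-intro (k * r) _ (trans
      (solve 2 (λ k r → (k :* r) :* (k :* r) := (k :* k) :* (r :* r)) refl k r) (cong ((k * k) *_) r²≡d))

  r≢-r : ∀ r → r ≢ 0# → r ≢ - r
  r≢-r r r≢0 r≡-r = x*y≢0 two r two≢0 r≢0 (begin
    two * r   ≡⟨ solve 1 (λ r → con (+ 2) :* r := r :+ r) refl r ⟩
    r + r     ≡⟨ cong (λ z → r + z) r≡-r ⟩
    r + - r   ≡⟨ -‿inverseʳ r ⟩
    0#        ∎)

  s²≡r²⇒s≡±r : ∀ s r → s * s ≡ r * r → s ≡ r ⊎ s ≡ - r
  s²≡r²⇒s≡±r s r h with x*y≡0 (s − r) (s + r) (begin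
    (s − r) * (s + r)     ≡⟨ solve 2 (λ s r → (s :- r) :* (s :+ r) := s :* s :- r :* r) refl s r ⟩
    s * s − r * r         ≡⟨ cong (_− r * r) h ⟩
    r * r − r * r         ≡⟨ -‿inverseʳ (r * r) ⟩
    0#                    ∎)
  ... | inj₁ e = inj₁ (x−y≡0⇒x≡y s r e)
  ... | inj₂ e = inj₂ (x+y≡0⇒x≡-y s r e)

  #roots : Carrier → ℕ
  #roots d = count (λ s → eqᵇ (s * s) d) elements

  #roots-0 : #roots 0# ≡ 1
  #roots-0 = begin
    #roots 0#                          ≡⟨ count-cong _ _ elements (λ s _ → eqᵇ-cong (λ e → sym (x*x≡0⇒x≡0 s e)) (λ { refl → zeroˡ 0# })) ⟩
    count (eqᵇ 0#) elements            ≡⟨ count≡∑ _ elements ⟩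
    ∑[ s ∈ elements ] toℕ (eqᵇ 0# s)   ≡⟨ ElementCounting.∑-==≡1 0# elements elements-unique (elements-complete 0#) ⟩
    1                                  ∎

  #roots-square : ∀ r → r ≢ 0# → #roots (r * r) ≡ 2
  #roots-square r r≢0 = ElementCounting.count≡2 _ elements elements-unique r (- r) (r≢-r r r≢0)
    (elements-complete r) (elements-complete (- r))
    (eqᵇ-refl _) (subst (λ z → eqᵇ z (r * r) ≡ true) (solve 1 (λ r → r :* r := (:- r) :* (:- r)) refl r) (eqᵇ-refl _))
    (λ s _ e → s²≡r²⇒s≡±r s r (eqᵇ-sound _ _ e))

  #roots-nonsquare : ∀ d → isSquare d ≡ false → #roots d ≡ 0
  #roots-nonsquare d h = trans (count-cong _ (λ _ → false) elements no-root) (count-const-false elements)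
    where
    no-root : ∀ s → s ∈ elements → eqᵇ (s * s) d ≡ false
    no-root s _ with eqᵇ (s * s) d in e
    ... | false = refl
    ... | true with () ← trans (sym (isSquare-intro s d (eqᵇ-sound _ _ e))) h

  isZero isNonzeroSquare : Carrier → Bool
  isZero d = eqᵇ d 0#
  isNonzeroSquare d = isSquare d ∧ not (isZero d)

  #roots-by-class : ∀ d → #roots d ≡ toℕ (isZero d) ℕ.+ (toℕ (isNonzeroSquare d) ℕ.+ toℕ (isNonzeroSquare d))
  #roots-by-class d with d ≟ 0#
  ... | yes refl rewrite isSquare-0 = #roots-0
  ... | no d≢0 with isSquare d in sq
  ...   | false = #roots-nonsquare d sq
  ...   | true with isSquare-elim d sq
  ...     | r , refl = #roots-square r (λ { refl → d≢0 (zeroˡ 0#) })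

  #roots-even : ∀ d → d ≢ 0# → ∃ λ s → #roots d ≡ s ℕ.+ s
  #roots-even d d≢0 = toℕ (isNonzeroSquare d) , trans (#roots-by-class d) (cong (λ b → toℕ b ℕ.+ (toℕ (isNonzeroSquare d) ℕ.+ toℕ (isNonzeroSquare d))) (eqᵇ-complete d 0# d≢0))

  #roots≡0 : ∀ d → (#roots d ℕ.≡ᵇ 0) ≡ not (isSquare d)
  #roots≡0 d with isSquare d in sq
  ... | false = cong (ℕ._≡ᵇ 0) (#roots-nonsquare d sq)
  ... | true with isSquare-elim d sq
  ...   | r , refl with r ≟ 0#
  ...     | yes refl = cong (ℕ._≡ᵇ 0) (trans (cong #roots (zeroˡ 0#)) #roots-0)
  ...     | no r≢0 = cong (ℕ._≡ᵇ 0) (#roots-square r r≢0)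

  #nonzeroSquares #nonsquares : ℕ
  #nonzeroSquares = count isNonzeroSquare elements
  #nonsquares = count (λ d → not (isSquare d)) elements

  #zero≡1 : ∑[ d ∈ elements ] toℕ (isZero d) ≡ 1
  #zero≡1 = trans (∑-cong _ _ elements (λ d _ → cong toℕ (eqᵇ-cong sym sym)))
                  (ElementCounting.∑-==≡1 0# elements elements-unique (elements-complete 0#))

  -- Each element has exactly one square, and each nonzero square has exactly two roots.
  order≡1+2·#nonzeroSquares : order ≡ 1 ℕ.+ (#nonzeroSquares ℕ.+ #nonzeroSquares)
  order≡1+2·#nonzeroSquares = begin
    order                                                                     ≡⟨ ∑-1 elements ⟨
    ∑[ s ∈ elements ] 1                                                       ≡⟨ ∑-cong _ _ elements (λ s _ → sym (ElementCounting.∑-==≡1 (s * s) elements elements-unique (elements-complete _))) ⟩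
    ∑[ s ∈ elements ] ∑[ d ∈ elements ] toℕ (eqᵇ (s * s) d)                   ≡⟨ ∑-comm (λ s d → toℕ (eqᵇ (s * s) d)) elements elements ⟩
    ∑[ d ∈ elements ] ∑[ s ∈ elements ] toℕ (eqᵇ (s * s) d)                   ≡⟨ ∑-cong _ _ elements (λ d _ → sym (count≡∑ _ elements)) ⟩
    ∑[ d ∈ elements ] #roots d                                                ≡⟨ ∑-cong _ _ elements (λ d _ → #roots-by-class d) ⟩
    ∑[ d ∈ elements ] (toℕ (isZero d) ℕ.+ (toℕ (isNonzeroSquare d) ℕ.+ toℕ (isNonzeroSquare d)))
                                                                              ≡⟨ ∑-+ _ _ elements ⟩
    ∑[ d ∈ elements ] toℕ (isZero d) ℕ.+ ∑[ d ∈ elements ] (toℕ (isNonzeroSquare d) ℕ.+ toℕ (isNonzeroSquare d))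
                                                                              ≡⟨ cong₂ ℕ._+_ #zero≡1 (∑-+ _ _ elements) ⟩
    1 ℕ.+ (∑[ d ∈ elements ] toℕ (isNonzeroSquare d) ℕ.+ ∑[ d ∈ elements ] toℕ (isNonzeroSquare d))
                                                                              ≡⟨ cong (λ n → 1 ℕ.+ (n ℕ.+ n)) (count≡∑ _ elements) ⟨
    1 ℕ.+ (#nonzeroSquares ℕ.+ #nonzeroSquares)                               ∎

  order≡1+#nonzeroSquares+#nonsquares : order ≡ 1 ℕ.+ (#nonzeroSquares ℕ.+ #nonsquares)
  order≡1+#nonzeroSquares+#nonsquares = begin
    order                                                                     ≡⟨ ∑-1 elements ⟨
    ∑[ d ∈ elements ] 1                                                       ≡⟨ ∑-cong _ _ elements trichotomy ⟩
    ∑[ d ∈ elements ] (toℕ (isZero d) ℕ.+ (toℕ (isNonzeroSquare d) ℕ.+ toℕ (not (isSquare d))))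
                                                                              ≡⟨ ∑-+ _ _ elements ⟩
    ∑[ d ∈ elements ] toℕ (isZero d) ℕ.+ ∑[ d ∈ elements ] (toℕ (isNonzeroSquare d) ℕ.+ toℕ (not (isSquare d)))
                                                                              ≡⟨ cong₂ ℕ._+_ #zero≡1 (∑-+ _ _ elements) ⟩
    1 ℕ.+ (∑[ d ∈ elements ] toℕ (isNonzeroSquare d) ℕ.+ ∑[ d ∈ elements ] toℕ (not (isSquare d)))
                                                                              ≡⟨ cong₂ (λ m n → 1 ℕ.+ (m ℕ.+ n)) (count≡∑ _ elements) (count≡∑ _ elements) ⟨
    1 ℕ.+ (#nonzeroSquares ℕ.+ #nonsquares)                                   ∎
    where
    trichotomy : ∀ d → d ∈ elements → 1 ≡ toℕ (isZero d) ℕ.+ (toℕ (isNonzeroSquare d) ℕ.+ toℕ (not (isSquare d)))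
    trichotomy d _ with d ≟ 0#
    ... | yes refl rewrite isSquare-0 = refl
    ... | no _ with isSquare d
    ...   | true = refl
    ...   | false = refl

  #nonzeroSquares≡#nonsquares : #nonzeroSquares ≡ #nonsquares
  #nonzeroSquares≡#nonsquares = ℕₚ.+-cancelˡ-≡ #nonzeroSquares _ _
    (ℕₚ.suc-injective (trans (sym order≡1+2·#nonzeroSquares) order≡1+#nonzeroSquares+#nonsquares))

  square*square : ∀ a b → isSquare a ≡ true → isSquare b ≡ true → isSquare (a * b) ≡ true
  square*square a b sa sb with isSquare-elim a sa | isSquare-elim b sb
  ... | r , refl | s , refl = isSquare-intro (r * s) _ (solve 2 (λ r s → (r :* s) :* (r :* s) := (r :* r) :* (s :* s)) refl r s)

  square*nonsquare : ∀ a b → a ≢ 0# → isSquare a ≡ true → isSquare b ≡ false → isSquare (a * b) ≡ false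
  square*nonsquare a b a≢0 sa nb with isSquare-elim a sa
  ... | r , refl = trans (isSquare-*-square r b (λ { refl → a≢0 (zeroˡ 0#) })) nb

  -- Multiplication by a nonsquare n is a bijection taking nonzero squares to nonsquares; as there
  -- are as many nonsquares as nonzero squares, it must take every nonsquare to a square.
  nonsquare*nonsquare : ∀ n m → isSquare n ≡ false → isSquare m ≡ false → isSquare (n * m) ≡ true
  nonsquare*nonsquare n m nn nm =
    count-≡⇒⇐ zeroOrNonsquare (λ x → isSquare (n * x)) elements n*x-square⇒ (begin
      count (λ x → isSquare (n * x)) elements   ≡⟨ count-∘-bijection isSquare (n *_) (inv n n≢0 *_) (x*[x⁻¹*y]≡y n n≢0) (x⁻¹*[x*y]≡y n n≢0) ⟩
      count isSquare elements                   ≡⟨ count≡1+count isSquare isNonzeroSquare square-split ⟩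
      1 ℕ.+ #nonzeroSquares                     ≡⟨ cong (1 ℕ.+_) #nonzeroSquares≡#nonsquares ⟩
      1 ℕ.+ #nonsquares                         ≡⟨ count≡1+count zeroOrNonsquare (λ d → not (isSquare d)) nonsquare-split ⟨
      count zeroOrNonsquare elements            ∎)
      m (elements-complete m) (trans (cong (λ b → isZero m ∨ not b) nm) (Boolₚ.∨-zeroʳ (isZero m)))
    where
    n≢0 : n ≢ 0#
    n≢0 = nonsquare≢0 n nn
    zeroOrNonsquare : Carrier → Bool
    zeroOrNonsquare x = isZero x ∨ not (isSquare x)
    n*x-square⇒ : (λ x → isSquare (n * x)) ⇒ᵇ zeroOrNonsquare
    n*x-square⇒ x snx with x ≟ 0#
    ... | yes refl = refl
    ... | no x≢0 with isSquare x in sx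
    ...   | false = refl
    ...   | true with () ← trans (sym snx) (trans (cong isSquare (*-comm n x)) (square*nonsquare x n x≢0 sx nn))
    square-split : ∀ d → toℕ (isSquare d) ≡ toℕ (isZero d) ℕ.+ toℕ (isNonzeroSquare d)
    square-split d with d ≟ 0#
    ... | yes refl rewrite isSquare-0 = refl
    ... | no _ with isSquare d
    ...   | true = refl
    ...   | false = refl
    nonsquare-split : ∀ d → toℕ (zeroOrNonsquare d) ≡ toℕ (isZero d) ℕ.+ toℕ (not (isSquare d))
    nonsquare-split d with d ≟ 0#
    ... | yes refl rewrite isSquare-0 = refl
    ... | no _ = refl
    count≡1+count : (p q : Carrier → Bool) → (∀ d → toℕ (p d) ≡ toℕ (isZero d) ℕ.+ toℕ (q d)) →
                    count p elements ≡ 1 ℕ.+ count q elements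
    count≡1+count p q split = begin
      count p elements                                                     ≡⟨ count≡∑ p elements ⟩
      ∑[ d ∈ elements ] toℕ (p d)                                          ≡⟨ ∑-cong _ _ elements (λ d _ → split d) ⟩
      ∑[ d ∈ elements ] (toℕ (isZero d) ℕ.+ toℕ (q d))                     ≡⟨ ∑-+ _ _ elements ⟩
      ∑[ d ∈ elements ] toℕ (isZero d) ℕ.+ ∑[ d ∈ elements ] toℕ (q d)    ≡⟨ cong₂ ℕ._+_ #zero≡1 (sym (count≡∑ q elements)) ⟩
      1 ℕ.+ count q elements                                               ∎

  isSquare-* : ∀ a b → a ≢ 0# → b ≢ 0# → isSquare (a * b) ≡ not (isSquare a xor isSquare b)
  isSquare-* a b a≢0 b≢0 with isSquare a in sa | isSquare b in sb
  ... | true | true = square*square a b sa sb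
  ... | true | false = square*nonsquare a b a≢0 sa sb
  ... | false | true = trans (cong isSquare (*-comm a b)) (square*nonsquare b a b≢0 sb sa)
  ... | false | false = nonsquare*nonsquare a b sa sb

module Coordinates (F : FiniteField) where
  open Field F
  open PG2 F
  open Counting F
  open ≡-Reasoning

  zeroVec : Triple
  zeroVec = (0# , 0# , 0#)

  scale : Carrier → Triple → Triple
  scale k (x , y , z) = (k * x , k * y , k * z)

  infixl 6 _−ᵥ_
  _−ᵥ_ : Triple → Triple → Triple
  (x , y , z) −ᵥ (x' , y' , z') = (x − x' , y − y' , z − z')

  cross : Triple → Triple → Triple
  cross (a₀ , a₁ , a₂) (b₀ , b₁ , b₂) = (a₁ * b₂ − a₂ * b₁ , a₂ * b₀ − a₀ * b₂ , a₀ * b₁ − a₁ * b₀)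

  triple-≡ : ∀ {a b c a' b' c' : Carrier} → a ≡ a' → b ≡ b' → c ≡ c' → _≡_ {A = Triple} (a , b , c) (a' , b' , c')
  triple-≡ refl refl refl = refl

  coord₀ coord₁ coord₂ : Triple → Carrier
  coord₀ (a , _ , _) = a
  coord₁ (_ , b , _) = b
  coord₂ (_ , _ , c) = c

  normalized≢zeroVec : ∀ {v} → Normalized v → v ≢ zeroVec
  normalized≢zeroVec (inj₁ e) refl = 0≢1 e
  normalized≢zeroVec (inj₂ (inj₁ (_ , e))) refl = 0≢1 e
  normalized≢zeroVec (inj₂ (inj₂ (_ , _ , e))) refl = 0≢1 e

  eqTᵇ-refl : ∀ v → eqTᵇ v v ≡ true
  eqTᵇ-refl (a , b , c) rewrite eqᵇ-refl a | eqᵇ-refl b | eqᵇ-refl c = refl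

  eqTᵇ-sound : ∀ v w → eqTᵇ v w ≡ true → v ≡ w
  eqTᵇ-sound (a , b , c) (a' , b' , c') h with eqᵇ a a' in e₁ | eqᵇ b b' in e₂ | eqᵇ c c' in e₃ | h
  ... | true | true | true | _ = triple-≡ (eqᵇ-sound _ _ e₁) (eqᵇ-sound _ _ e₂) (eqᵇ-sound _ _ e₃)

  module TripleCounting = BooleanEquality eqTᵇ eqTᵇ-refl eqTᵇ-sound
  open TripleCounting public using () renaming (==-complete to eqTᵇ-complete)

  incᵇ⇒dot≡0 : ∀ {x ℓ} → incᵇ x ℓ ≡ true → dot x ℓ ≡ 0#
  incᵇ⇒dot≡0 = eqᵇ-sound _ _

  dot≡0⇒incᵇ : ∀ {x ℓ} → dot x ℓ ≡ 0# → incᵇ x ℓ ≡ true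
  dot≡0⇒incᵇ h = subst (λ z → eqᵇ z 0# ≡ true) (sym h) (eqᵇ-refl 0#)

  row : Carrier → List Triple
  row b = map (λ c → (1# , b , c)) elements

  allTriples-unique : Unique allTriples
  allTriples-unique = Uniqueₚ.++⁺ unique₁ (Uniqueₚ.++⁺ unique₂ ([] ∷ []) disjoint₂₃) disjoint₁
    where
    unique₁ : Unique (concatMap row elements)
    unique₁ = Uniqueₚ.concat⁺ (Allₚ.map⁺ (All.universal (λ b → Uniqueₚ.map⁺ (cong coord₂) elements-unique) elements))
      (AllPairsₚ.map⁺ (AllPairs.map (λ b≢b' {v} (v∈ , v∈') → b≢b' (same-row v∈ v∈')) elements-unique))
      where
      same-row : ∀ {b b' v} → v ∈ row b → v ∈ row b' → b ≡ b'
      same-row {b} {b'} v∈ v∈' with ∈ₚ.∈-map⁻ (λ c → (1# , b , c)) v∈ | ∈ₚ.∈-map⁻ (λ c → (1# , b' , c)) v∈'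
      ... | _ , _ , refl | _ , _ , e = cong coord₁ e
    unique₂ : Unique (map (λ c → (0# , 1# , c)) elements)
    unique₂ = Uniqueₚ.map⁺ (cong coord₂) elements-unique
    disjoint₂₃ : ∀ {v} → ¬ (v ∈ map (λ c → (0# , 1# , c)) elements × v ∈ (0# , 0# , 1#) ∷ [])
    disjoint₂₃ (v∈ , here refl) with ∈ₚ.∈-map⁻ (λ c → (0# , 1# , c)) v∈
    ... | _ , _ , e = 0≢1 (cong coord₁ e)
    disjoint₁ : ∀ {v} → ¬ (v ∈ concatMap row elements × v ∈ map (λ c → (0# , 1# , c)) elements ++ (0# , 0# , 1#) ∷ [])
    disjoint₁ (v∈₁ , v∈₂₃) = 0≢1 (trans (sym (first≡0 v∈₂₃)) (first≡1 v∈₁))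
      where
      first≡1 : ∀ {v} → v ∈ concatMap row elements → coord₀ v ≡ 1#
      first≡1 v∈ with Any.satisfied (∈ₚ.∈-concatMap⁻ row {xs = elements} v∈)
      ... | b , v∈' with ∈ₚ.∈-map⁻ (λ c → (1# , b , c)) v∈'
      ... | _ , _ , refl = refl
      first≡0 : ∀ {v} → v ∈ map (λ c → (0# , 1# , c)) elements ++ (0# , 0# , 1#) ∷ [] → coord₀ v ≡ 0#
      first≡0 v∈ with ∈ₚ.∈-++⁻ (map (λ c → (0# , 1# , c)) elements) v∈
      ... | inj₂ (here refl) = refl
      ... | inj₁ v∈' with ∈ₚ.∈-map⁻ (λ c → (0# , 1# , c)) v∈'
      ...   | _ , _ , refl = refl

  normalized⇒∈allTriples : ∀ {v} → Normalized v → v ∈ allTriples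
  normalized⇒∈allTriples {_ , b , c} (inj₁ refl) =
    ∈ₚ.∈-++⁺ˡ (∈ₚ.∈-concatMap⁺ row (Any.map (λ { refl → ∈ₚ.∈-map⁺ (λ c → (1# , b , c)) (elements-complete c) }) (elements-complete b)))
  normalized⇒∈allTriples {_ , _ , c} (inj₂ (inj₁ (refl , refl))) =
    ∈ₚ.∈-++⁺ʳ (concatMap row elements) (∈ₚ.∈-++⁺ˡ (∈ₚ.∈-map⁺ (λ c → (0# , 1# , c)) (elements-complete c)))
  normalized⇒∈allTriples (inj₂ (inj₂ (refl , refl , refl))) =
    ∈ₚ.∈-++⁺ʳ (concatMap row elements) (∈ₚ.∈-++⁺ʳ (map (λ c → (0# , 1# , c)) elements) (here refl))

  ∈allTriples⇒normalized : ∀ {v} → v ∈ allTriples → Normalized v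
  ∈allTriples⇒normalized v∈ with ∈ₚ.∈-++⁻ (concatMap (λ b → map (λ c → (1# , b , c)) elements) elements) v∈
  ... | inj₁ v∈₁ with Any.satisfied (∈ₚ.∈-concatMap⁻ (λ b → map (λ c → (1# , b , c)) elements) {xs = elements} v∈₁)
  ...   | b , v∈' with ∈ₚ.∈-map⁻ (λ c → (1# , b , c)) v∈'
  ...     | _ , _ , refl = inj₁ refl
  ∈allTriples⇒normalized v∈ | inj₂ v∈₂₃ with ∈ₚ.∈-++⁻ (map (λ c → (0# , 1# , c)) elements) v∈₂₃
  ... | inj₂ (here refl) = inj₂ (inj₂ (refl , refl , refl))
  ... | inj₁ v∈₂ with ∈ₚ.∈-map⁻ (λ c → (0# , 1# , c)) v∈₂
  ...   | _ , _ , refl = inj₂ (inj₁ (refl , refl))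

  scale-1 : ∀ v → scale 1# v ≡ v
  scale-1 (a , b , c) = triple-≡ (*-identityˡ a) (*-identityˡ b) (*-identityˡ c)

  scale-0 : ∀ v → scale 0# v ≡ zeroVec
  scale-0 (a , b , c) = triple-≡ (zeroˡ a) (zeroˡ b) (zeroˡ c)

  scale-scale : ∀ a b v → scale a (scale b v) ≡ scale (a * b) v
  scale-scale a b (v₀ , v₁ , v₂) = triple-≡ (sym (*-assoc a b v₀)) (sym (*-assoc a b v₁)) (sym (*-assoc a b v₂))

  scale≢zeroVec⇒≢0 : ∀ k v → scale k v ≢ zeroVec → k ≢ 0#
  scale≢zeroVec⇒≢0 k v kv≢0 refl = kv≢0 (scale-0 v)

  private
    k*1≡1 : ∀ {k} → k * 1# ≡ 1# → k ≡ 1#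
    k*1≡1 {k} = trans (sym (*-identityʳ k))

    k*1≡0⇒k*x≢1 : ∀ {k} x → k * 1# ≡ 0# → k * x ≢ 1#
    k*1≡0⇒k*x≢1 {k} x k≡0 kx≡1 = 0≢1 (trans (sym (zeroˡ x)) (trans (cong (_* x) (sym (trans (sym (*-identityʳ k)) k≡0))) kx≡1))

    k*0≢1 : ∀ k → k * 0# ≢ 1#
    k*0≢1 k e = 0≢1 (trans (sym (zeroʳ k)) e)

  normalized-scale : ∀ {v w} k → Normalized v → Normalized w → w ≡ scale k v → w ≡ v
  normalized-scale {_ , b , c} k (inj₁ refl) nw refl with nw
  ... | inj₁ e = trans (cong (λ z → scale z (1# , b , c)) (k*1≡1 e)) (scale-1 _)
  ... | inj₂ (inj₁ (e₀ , e₁)) = ⊥-elim (k*1≡0⇒k*x≢1 b e₀ e₁)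
  ... | inj₂ (inj₂ (e₀ , _ , e₂)) = ⊥-elim (k*1≡0⇒k*x≢1 c e₀ e₂)
  normalized-scale {_ , _ , c} k (inj₂ (inj₁ (refl , refl))) nw refl with nw
  ... | inj₁ e = ⊥-elim (k*0≢1 k e)
  ... | inj₂ (inj₁ (_ , e₁)) = trans (cong (λ z → scale z (0# , 1# , c)) (k*1≡1 e₁)) (scale-1 _)
  ... | inj₂ (inj₂ (_ , e₁ , e₂)) = ⊥-elim (k*1≡0⇒k*x≢1 c e₁ e₂)
  normalized-scale k (inj₂ (inj₂ (refl , refl , refl))) nw refl with nw
  ... | inj₁ e = ⊥-elim (k*0≢1 k e)
  ... | inj₂ (inj₁ (_ , e₁)) = ⊥-elim (k*0≢1 k e₁)
  ... | inj₂ (inj₂ (_ , _ , e₂)) = trans (cong (λ z → scale z (0# , 0# , 1#)) (k*1≡1 e₂)) (scale-1 _)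

  normalize : ∀ v → v ≢ zeroVec → ∃ λ k → k ≢ 0# × Normalized (scale k v)
  normalize (a , b , c) v≢0 with a ≟ 0#
  ... | no a≢0 = inv a a≢0 , inv≢0 a a≢0 , inj₁ (inv-inverseˡ a a≢0)
  ... | yes refl with b ≟ 0#
  ...   | no b≢0 = inv b b≢0 , inv≢0 b b≢0 , inj₂ (inj₁ (zeroʳ _ , inv-inverseˡ b b≢0))
  ...   | yes refl with c ≟ 0#
  ...     | no c≢0 = inv c c≢0 , inv≢0 c c≢0 , inj₂ (inj₂ (zeroʳ _ , zeroʳ _ , inv-inverseˡ c c≢0))
  ...     | yes refl = ⊥-elim (v≢0 refl)

  private
    ratio : ∀ {p q r s} (q≢0 : q ≢ 0#) → p * q ≡ r * s → p ≡ (r * inv q q≢0) * s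
    ratio {p} {q} {r} {s} q≢0 e = begin
      p                  ≡⟨ [y*x]*x⁻¹≡y q q≢0 p ⟨
      (p * q) * inv q q≢0 ≡⟨ cong (_* inv q q≢0) e ⟩
      (r * s) * inv q q≢0 ≡⟨ solve 3 (λ r s w → (r :* s) :* w := (r :* w) :* s) refl r s (inv q q≢0) ⟩
      (r * inv q q≢0) * s ∎

  proportional : ∀ {x₀ x₁ x₂ v₀ v₁ v₂} → _≢_ {A = Triple} (v₀ , v₁ , v₂) zeroVec →
    x₁ * v₂ ≡ x₂ * v₁ → x₂ * v₀ ≡ x₀ * v₂ → x₀ * v₁ ≡ x₁ * v₀ → ∃ λ k → _≡_ {A = Triple} (x₀ , x₁ , x₂) (scale k (v₀ , v₁ , v₂))
  proportional {x₀} {x₁} {x₂} {v₀} {v₁} {v₂} v≢0 e₀ e₁ e₂ with v₀ ≟ 0# | v₁ ≟ 0# | v₂ ≟ 0#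
  ... | no v₀≢0 | _ | _ = x₀ * inv v₀ v₀≢0 , triple-≡ (ratio v₀≢0 refl) (ratio v₀≢0 (sym e₂)) (ratio v₀≢0 e₁)
  ... | yes refl | no v₁≢0 | _ = x₁ * inv v₁ v₁≢0 , triple-≡ (ratio v₁≢0 e₂) (ratio v₁≢0 refl) (ratio v₁≢0 (sym e₀))
  ... | yes refl | yes refl | no v₂≢0 = x₂ * inv v₂ v₂≢0 , triple-≡ (ratio v₂≢0 (sym e₁)) (ratio v₂≢0 e₀) (ratio v₂≢0 refl)
  ... | yes refl | yes refl | yes refl = ⊥-elim (v≢0 refl)

  cross≡zeroVec⇒parallel : ∀ x v → v ≢ zeroVec → cross x v ≡ zeroVec → ∃ λ k → x ≡ scale k v
  cross≡zeroVec⇒parallel (x₀ , x₁ , x₂) (v₀ , v₁ , v₂) v≢0 x×v≡0 =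
    proportional v≢0 (x−y≡0⇒x≡y _ _ (cong coord₀ x×v≡0)) (x−y≡0⇒x≡y _ _ (cong coord₁ x×v≡0)) (x−y≡0⇒x≡y _ _ (cong coord₂ x×v≡0))

  cross≢zeroVec : ∀ {v w} → Normalized v → Normalized w → v ≢ w → cross v w ≢ zeroVec
  cross≢zeroVec {v} {w} nv nw v≢w v×w≡0 with cross≡zeroVec⇒parallel v w (normalized≢zeroVec nw) v×w≡0
  ... | k , v≡kw = v≢w (normalized-scale k nw nv v≡kw)

  dot-comm : ∀ x y → dot x y ≡ dot y x
  dot-comm (a₀ , a₁ , a₂) (b₀ , b₁ , b₂) =
    solve 6 (λ a₀ a₁ a₂ b₀ b₁ b₂ → a₀ :* b₀ :+ a₁ :* b₁ :+ a₂ :* b₂ := b₀ :* a₀ :+ b₁ :* a₁ :+ b₂ :* a₂) refl a₀ a₁ a₂ b₀ b₁ b₂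

  dot-scaleˡ : ∀ k v w → dot (scale k v) w ≡ k * dot v w
  dot-scaleˡ k (a₀ , a₁ , a₂) (b₀ , b₁ , b₂) =
    solve 7 (λ k a₀ a₁ a₂ b₀ b₁ b₂ → (k :* a₀) :* b₀ :+ (k :* a₁) :* b₁ :+ (k :* a₂) :* b₂ := k :* (a₀ :* b₀ :+ a₁ :* b₁ :+ a₂ :* b₂))
      refl k a₀ a₁ a₂ b₀ b₁ b₂

  dot-cross-left : ∀ a b → dot (cross a b) a ≡ 0#
  dot-cross-left (a₀ , a₁ , a₂) (b₀ , b₁ , b₂) =
    solve 6 (λ a₀ a₁ a₂ b₀ b₁ b₂ → (a₁ :* b₂ :- a₂ :* b₁) :* a₀ :+ (a₂ :* b₀ :- a₀ :* b₂) :* a₁ :+ (a₀ :* b₁ :- a₁ :* b₀) :* a₂ := con (+ 0))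
      refl a₀ a₁ a₂ b₀ b₁ b₂

  dot-cross-right : ∀ a b → dot (cross a b) b ≡ 0#
  dot-cross-right (a₀ , a₁ , a₂) (b₀ , b₁ , b₂) =
    solve 6 (λ a₀ a₁ a₂ b₀ b₁ b₂ → (a₁ :* b₂ :- a₂ :* b₁) :* b₀ :+ (a₂ :* b₀ :- a₀ :* b₂) :* b₁ :+ (a₀ :* b₁ :- a₁ :* b₀) :* b₂ := con (+ 0))
      refl a₀ a₁ a₂ b₀ b₁ b₂

  cross-scaleʳ : ∀ p k w → cross p (scale k w) ≡ scale k (cross p w)
  cross-scaleʳ (p₀ , p₁ , p₂) k (w₀ , w₁ , w₂) = triple-≡ (law p₁ p₂ w₁ w₂) (law p₂ p₀ w₂ w₀) (law p₀ p₁ w₀ w₁)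
    where
    law : ∀ a b c d → a * (k * d) − b * (k * c) ≡ k * (a * d − b * c)
    law a b c d = solve 5 (λ a b c d k → a :* (k :* d) :- b :* (k :* c) := k :* (a :* d :- b :* c)) refl a b c d k

  cross-cross : ∀ x ℓ m → cross x (cross ℓ m) ≡ scale (dot x m) ℓ −ᵥ scale (dot x ℓ) m
  cross-cross (x₀ , x₁ , x₂) (l₀ , l₁ , l₂) (m₀ , m₁ , m₂) = triple-≡
    (solve 9 (λ x₀ x₁ x₂ l₀ l₁ l₂ m₀ m₁ m₂ → x₁ :* (l₀ :* m₁ :- l₁ :* m₀) :- x₂ :* (l₂ :* m₀ :- l₀ :* m₂)
      := (x₀ :* m₀ :+ x₁ :* m₁ :+ x₂ :* m₂) :* l₀ :- (x₀ :* l₀ :+ x₁ :* l₁ :+ x₂ :* l₂) :* m₀) refl x₀ x₁ x₂ l₀ l₁ l₂ m₀ m₁ m₂)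
    (solve 9 (λ x₀ x₁ x₂ l₀ l₁ l₂ m₀ m₁ m₂ → x₂ :* (l₁ :* m₂ :- l₂ :* m₁) :- x₀ :* (l₀ :* m₁ :- l₁ :* m₀)
      := (x₀ :* m₀ :+ x₁ :* m₁ :+ x₂ :* m₂) :* l₁ :- (x₀ :* l₀ :+ x₁ :* l₁ :+ x₂ :* l₂) :* m₁) refl x₀ x₁ x₂ l₀ l₁ l₂ m₀ m₁ m₂)
    (solve 9 (λ x₀ x₁ x₂ l₀ l₁ l₂ m₀ m₁ m₂ → x₀ :* (l₂ :* m₀ :- l₀ :* m₂) :- x₁ :* (l₁ :* m₂ :- l₂ :* m₁)
      := (x₀ :* m₀ :+ x₁ :* m₁ :+ x₂ :* m₂) :* l₂ :- (x₀ :* l₀ :+ x₁ :* l₁ :+ x₂ :* l₂) :* m₂) refl x₀ x₁ x₂ l₀ l₁ l₂ m₀ m₁ m₂)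

  on-both⇒parallel-cross : ∀ x ℓ m → dot x ℓ ≡ 0# → dot x m ≡ 0# → cross x (cross ℓ m) ≡ zeroVec
  on-both⇒parallel-cross x ℓ m x·ℓ≡0 x·m≡0 = begin
    cross x (cross ℓ m)                          ≡⟨ cross-cross x ℓ m ⟩
    scale (dot x m) ℓ −ᵥ scale (dot x ℓ) m       ≡⟨ cong₂ (λ a b → scale a ℓ −ᵥ scale b m) x·m≡0 x·ℓ≡0 ⟩
    scale 0# ℓ −ᵥ scale 0# m                     ≡⟨ cong₂ _−ᵥ_ (scale-0 ℓ) (scale-0 m) ⟩
    zeroVec −ᵥ zeroVec                           ≡⟨ triple-≡ 0−0 0−0 0−0 ⟩
    zeroVec                                      ∎
    where
    0−0 : 0# − 0# ≡ 0#
    0−0 = -‿inverseʳ 0#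

  scale-on : ∀ k {x ℓ} → dot x ℓ ≡ 0# → dot (scale k x) ℓ ≡ 0#
  scale-on k {x} {ℓ} x·ℓ≡0 = trans (dot-scaleˡ k x ℓ) (trans (cong (k *_) x·ℓ≡0) (zeroʳ k))

  meet-point : ∀ {ℓ m} → Normalized ℓ → Normalized m → ℓ ≢ m → ∃ λ x → Normalized x × dot x ℓ ≡ 0# × dot x m ≡ 0#
  meet-point {ℓ} {m} nℓ nm ℓ≢m with normalize (cross ℓ m) (cross≢zeroVec nℓ nm ℓ≢m)
  ... | k , _ , nx = scale k (cross ℓ m) , nx , scale-on k (dot-cross-left ℓ m) , scale-on k (dot-cross-right ℓ m)

  meet-on-both : ∀ x ℓ m → dot x ℓ ≡ 0# → dot x m ≡ 0# → Normalized ℓ → Normalized m → ℓ ≢ m →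
                 ∃ λ k → x ≡ scale k (cross ℓ m)
  meet-on-both x ℓ m x·ℓ≡0 x·m≡0 nℓ nm ℓ≢m =
    cross≡zeroVec⇒parallel x (cross ℓ m) (cross≢zeroVec nℓ nm ℓ≢m) (on-both⇒parallel-cross x ℓ m x·ℓ≡0 x·m≡0)

  meet-unique : ∀ {ℓ m x y} → Normalized ℓ → Normalized m → ℓ ≢ m → Normalized x → Normalized y →
    dot x ℓ ≡ 0# → dot x m ≡ 0# → dot y ℓ ≡ 0# → dot y m ≡ 0# → y ≡ x
  meet-unique {ℓ} {m} {x} {y} nℓ nm ℓ≢m nx ny x·ℓ x·m y·ℓ y·m =
    same-multiple (meet-on-both x ℓ m x·ℓ x·m nℓ nm ℓ≢m) (meet-on-both y ℓ m y·ℓ y·m nℓ nm ℓ≢m)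
    where
    v = cross ℓ m
    same-multiple : (∃ λ k → x ≡ scale k v) → (∃ λ j → y ≡ scale j v) → y ≡ x
    same-multiple (k , x≡kv) (j , y≡jv) = normalized-scale (j * inv k k≢0) nx ny (begin
        y                                  ≡⟨ y≡jv ⟩
        scale j v                          ≡⟨ cong (λ z → scale z v) ([y*x⁻¹]*x≡y k k≢0 j) ⟨
        scale ((j * inv k k≢0) * k) v      ≡⟨ scale-scale _ k v ⟨
        scale (j * inv k k≢0) (scale k v)  ≡⟨ cong (scale (j * inv k k≢0)) x≡kv ⟨
        scale (j * inv k k≢0) x            ∎)
      where
      k≢0 : k ≢ 0#
      k≢0 = scale≢zeroVec⇒≢0 k v (λ kv≡0 → normalized≢zeroVec nx (trans x≡kv kv≡0))

module Conic (F : FiniteField) (odd : FiniteField.order F % 2 ≡ 1) where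
  open Field F
  open OddOrder F odd
  open Squares F odd
  open PG2 F
  open Counting F
  open Coordinates F
  open ≡-Reasoning

  discriminant : Triple → Carrier
  discriminant (a , b , c) = b * b − four * a * c

  discriminant-scale : ∀ k v → discriminant (scale k v) ≡ (k * k) * discriminant v
  discriminant-scale k (a , b , c) =
    solve 4 (λ k a b c → (k :* b) :* (k :* b) :- con (+ 4) :* (k :* a) :* (k :* c) := (k :* k) :* (b :* b :- con (+ 4) :* a :* c))
      refl k a b c

  affinePoint : Carrier → Triple
  affinePoint t = (1# , t , t * t)

  pointAtInfinity : Triple
  pointAtInfinity = (0# , 0# , 1#)

  #affinePointsOn : Triple → ℕ
  #affinePointsOn ℓ = count (λ t → incᵇ (affinePoint t) ℓ) elements

  dot-pointAtInfinity : ∀ a b c → dot pointAtInfinity (a , b , c) ≡ c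
  dot-pointAtInfinity a b c =
    trans (solve 4 (λ a b c one → con (+ 0) :* a :+ con (+ 0) :* b :+ one :* c := one :* c) refl a b c 1#) (*-identityˡ c)

  -- Completing the square: t is a root of a + b t + c t² iff 2ct + b is a square root of the discriminant.
  nO≡#roots : ∀ a b c → c ≢ 0# → nO (a , b , c) ≡ #roots (discriminant (a , b , c))
  nO≡#roots a b c c≢0 = begin
      nO (a , b , c)                                         ≡⟨ cong (#affinePointsOn (a , b , c) ℕ.+_) ∞-not-on ⟩
      #affinePointsOn (a , b , c) ℕ.+ 0                      ≡⟨ ℕₚ.+-identityʳ _ ⟩
      #affinePointsOn (a , b , c)                            ≡⟨ count-cong _ _ elements (λ t _ → root⇔ t) ⟩
      count (λ t → eqᵇ (σ t * σ t) D) elements               ≡⟨ count-∘-bijection (λ s → eqᵇ (s * s) D) σ τ στ τσ ⟩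
      #roots D                                               ∎
    where
    D = discriminant (a , b , c)
    k = two * c
    k≢0 : k ≢ 0#
    k≢0 = x*y≢0 two c two≢0 c≢0
    σ τ : Carrier → Carrier
    σ t = k * t + b
    τ s = inv k k≢0 * (s − b)
    στ : ∀ s → σ (τ s) ≡ s
    στ s = trans (cong (_+ b) (x*[x⁻¹*y]≡y k k≢0 (s − b))) (solve 2 (λ s b → (s :- b) :+ b := s) refl s b)
    τσ : ∀ t → τ (σ t) ≡ t
    τσ t = trans (cong (inv k k≢0 *_) (solve 2 (λ kt b → (kt :+ b) :- b := kt) refl (k * t) b)) (x⁻¹*[x*y]≡y k k≢0 t)
    ∞-not-on : (if incᵇ pointAtInfinity (a , b , c) then 1 else 0) ≡ 0
    ∞-not-on rewrite eqᵇ-complete _ 0# (λ e → c≢0 (trans (sym (dot-pointAtInfinity a b c)) e)) = refl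
    value≡ : ∀ t → four * c * dot (affinePoint t) (a , b , c) ≡ σ t * σ t − D
    value≡ t = trans (cong (λ z → four * c * (z + t * b + (t * t) * c)) (*-identityˡ a))
      (solve 4 (λ a b c t → con (+ 4) :* c :* (a :+ t :* b :+ (t :* t) :* c)
        := (con (+ 2) :* c :* t :+ b) :* (con (+ 2) :* c :* t :+ b) :- (b :* b :- con (+ 4) :* a :* c)) refl a b c t)
    root⇔ : ∀ t → incᵇ (affinePoint t) (a , b , c) ≡ eqᵇ (σ t * σ t) D
    root⇔ t = eqᵇ-cong
      (λ e → x−y≡0⇒x≡y _ _ (trans (sym (value≡ t)) (trans (cong (four * c *_) e) (zeroʳ _))))
      (λ e → *-cancelˡ (four * c) _ 0# (x*y≢0 four c four≢0 c≢0)
               (trans (value≡ t) (trans (cong (_− D) e) (trans (-‿inverseʳ D) (sym (zeroʳ _))))))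

  nO≡1+#affinePointsOn : ∀ a b → nO (a , b , 0#) ≡ suc (#affinePointsOn (a , b , 0#))
  nO≡1+#affinePointsOn a b rewrite dot-pointAtInfinity a b 0# | eqᵇ-refl 0# = ℕₚ.+-comm _ 1

  line-through-∞-meets-affinely : ∀ a b (b≢0 : b ≢ 0#) → dot (affinePoint (- a * inv b b≢0)) (a , b , 0#) ≡ 0#
  line-through-∞-meets-affinely a b b≢0 = begin
    1# * a + t * b + (t * t) * 0#     ≡⟨ cong₂ (λ x y → x + t * b + y) (*-identityˡ a) (zeroʳ _) ⟩
    a + t * b + 0#                    ≡⟨ +-identityʳ _ ⟩
    a + (- a * inv b b≢0) * b         ≡⟨ cong (λ z → a + z) ([y*x⁻¹]*x≡y b b≢0 (- a)) ⟩
    a + - a                           ≡⟨ -‿inverseʳ a ⟩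
    0#                                ∎
    where t = - a * inv b b≢0

  no-affine-point⇒b≡0 : ∀ a b → #affinePointsOn (a , b , 0#) ≡ 0 → b ≡ 0#
  no-affine-point⇒b≡0 a b none with b ≟ 0#
  ... | yes b≡0 = b≡0
  ... | no b≢0 with () ← trans (sym (dot≡0⇒incᵇ (line-through-∞-meets-affinely a b b≢0)))
                               (count≡0⇒false _ elements none _ (elements-complete _))

  tangent⇒discriminant≡0 : ∀ ℓ → tangentᵇ ℓ ≡ true → discriminant ℓ ≡ 0#
  tangent⇒discriminant≡0 (a , b , c) tangent with c ≟ 0# | ℕₚ.≡ᵇ⇒≡ (nO (a , b , c)) 1 (Equivalence.from Boolₚ.T-≡ tangent)
  ... | yes refl | one rewrite no-affine-point⇒b≡0 a b (ℕₚ.suc-injective (trans (sym (nO≡1+#affinePointsOn a b)) one)) =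
    solve 1 (λ a → con (+ 0) :* con (+ 0) :- con (+ 4) :* a :* con (+ 0) := con (+ 0)) refl a
  ... | no c≢0 | one with discriminant (a , b , c) ≟ 0#
  ...   | yes D≡0 = D≡0
  ...   | no D≢0 with #roots-even _ D≢0
  ...     | s , even = ⊥-elim (odd≢even s (trans (sym (trans (sym (nO≡#roots a b c c≢0)) one)) even))
    where
    odd≢even : ∀ s → 1 ≢ s ℕ.+ s
    odd≢even (suc s) e with () ← trans e (ℕₚ.+-suc (suc s) s)

  passant≡nonsquare-discriminant : ∀ ℓ → passantᵇ ℓ ≡ not (isSquare (discriminant ℓ))
  passant≡nonsquare-discriminant (a , b , c) with c ≟ 0#
  ... | yes refl = trans (cong (ℕ._≡ᵇ 0) (nO≡1+#affinePointsOn a b)) (cong not (sym b²-square))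
    where
    b²-square : isSquare (discriminant (a , b , 0#)) ≡ true
    b²-square = isSquare-intro b _ (solve 2 (λ a b → b :* b := b :* b :- con (+ 4) :* a :* con (+ 0)) refl a b)
  ... | no c≢0 = trans (cong (ℕ._≡ᵇ 0) (nO≡#roots a b c c≢0)) (#roots≡0 (discriminant (a , b , c)))

  -- In the chart x₀ = 1 the conic is the parabola x₂ = x₁²; [0,0,1] is its tangent at the vertex
  -- (1,0,0), and every other tangent has a representative [1,b,c].
  data TangentForm : Triple → Set where
    generic : ∀ b c → b * b ≡ four * c → TangentForm (1# , b , c)
    vertex : TangentForm (0# , 0# , 1#)

  discriminant≡0⇒TangentForm : ∀ {ℓ} → Normalized ℓ → discriminant ℓ ≡ 0# → TangentForm ℓ
  discriminant≡0⇒TangentForm {_ , b , c} (inj₁ refl) D≡0 =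
    generic b c (trans (x−y≡0⇒x≡y _ _ D≡0) (cong (_* c) (*-identityʳ four)))
  discriminant≡0⇒TangentForm {_ , _ , c} (inj₂ (inj₁ (refl , refl))) D≡0 = ⊥-elim (1≢0 (begin
    1#                          ≡⟨ *-identityʳ 1# ⟨
    1# * 1#                     ≡⟨ solve 2 (λ c one → one :* one := one :* one :- con (+ 4) :* con (+ 0) :* c) refl c 1# ⟩
    1# * 1# − four * 0# * c     ≡⟨ D≡0 ⟩
    0#                          ∎))
  discriminant≡0⇒TangentForm (inj₂ (inj₂ (refl , refl , refl))) D≡0 = vertex

  tangent⇒TangentForm : ∀ {ℓ} → Normalized ℓ → tangentᵇ ℓ ≡ true → TangentForm ℓ
  tangent⇒TangentForm nℓ tangent = discriminant≡0⇒TangentForm nℓ (tangent⇒discriminant≡0 _ tangent)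

  generic-≡ : ∀ {b c b' c'} → b ≡ b' → b * b ≡ four * c → b' * b' ≡ four * c' → _≡_ {A = Triple} (1# , b , c) (1# , b' , c')
  generic-≡ refl b²≡4c b²≡4c' = triple-≡ refl refl (*-cancelˡ four _ _ four≢0 (trans (sym b²≡4c) b²≡4c'))

  linear-two-roots : ∀ {q r β β'} → q * β + r ≡ 0# → q * β' + r ≡ 0# → β ≢ β' → q ≡ 0# × r ≡ 0#
  linear-two-roots {q} {r} {β} {β'} root root' β≢β' = q≡0 , r≡0
    where
    q≡0 : q ≡ 0#
    q≡0 with x*y≡0 q (β − β') (begin
      q * (β − β')                    ≡⟨ solve 4 (λ q r β β' → q :* (β :- β') := (q :* β :+ r) :- (q :* β' :+ r)) refl q r β β' ⟩
      (q * β + r) − (q * β' + r)      ≡⟨ cong₂ _−_ root root' ⟩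
      0# − 0#                         ≡⟨ -‿inverseʳ 0# ⟩
      0#                              ∎)
    ... | inj₁ q≡0 = q≡0
    ... | inj₂ e = ⊥-elim (β≢β' (x−y≡0⇒x≡y β β' e))
    r≡0 : r ≡ 0#
    r≡0 = trans (sym (trans (cong (λ z → z * β + r) q≡0) (solve 2 (λ β r → con (+ 0) :* β :+ r := r) refl β r))) root

  quadratic-three-roots : ∀ {p q r β₁ β₂ β₃} →
    p * (β₁ * β₁) + q * β₁ + r ≡ 0# → p * (β₂ * β₂) + q * β₂ + r ≡ 0# → p * (β₃ * β₃) + q * β₃ + r ≡ 0# →
    β₁ ≢ β₂ → β₁ ≢ β₃ → β₂ ≢ β₃ → p ≡ 0# × q ≡ 0# × r ≡ 0#
  quadratic-three-roots {p} {q} {r} {β₁} {β₂} {β₃} root₁ root₂ root₃ β₁≢β₂ β₁≢β₃ β₂≢β₃ =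
    p≡0 , linear-two-roots (as-linear root₁) (as-linear root₂) β₁≢β₂
    where
    secant : ∀ {β β'} → p * (β * β) + q * β + r ≡ 0# → p * (β' * β') + q * β' + r ≡ 0# → β ≢ β' → p * (β + β') + q ≡ 0#
    secant {β} {β'} root root' β≢β' with x*y≡0 (β − β') (p * (β + β') + q) (begin
      (β − β') * (p * (β + β') + q)                               ≡⟨ solve 5 (λ p q r β β' → (β :- β') :* (p :* (β :+ β') :+ q)
                                                                        := (p :* (β :* β) :+ q :* β :+ r) :- (p :* (β' :* β') :+ q :* β' :+ r)) refl p q r β β' ⟩
      (p * (β * β) + q * β + r) − (p * (β' * β') + q * β' + r)    ≡⟨ cong₂ _−_ root root' ⟩
      0# − 0#                                                     ≡⟨ -‿inverseʳ 0# ⟩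
      0#                                                          ∎)
    ... | inj₁ e = ⊥-elim (β≢β' (x−y≡0⇒x≡y β β' e))
    ... | inj₂ e = e
    p≡0 : p ≡ 0#
    p≡0 = proj₁ (linear-two-roots {β = β₂} {β' = β₃}
      (trans (solve 4 (λ p q b β → p :* β :+ (p :* b :+ q) := p :* (b :+ β) :+ q) refl p q β₁ β₂) (secant root₁ root₂ β₁≢β₂))
      (trans (solve 4 (λ p q b β → p :* β :+ (p :* b :+ q) := p :* (b :+ β) :+ q) refl p q β₁ β₃) (secant root₁ root₃ β₁≢β₃))
      β₂≢β₃)
    as-linear : ∀ {β} → p * (β * β) + q * β + r ≡ 0# → q * β + r ≡ 0#
    as-linear {β} root = trans (solve 3 (λ q β r → q :* β :+ r := con (+ 0) :* (β :* β) :+ q :* β :+ r) refl q β r)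
                               (trans (cong (λ z → z * (β * β) + q * β + r) (sym p≡0)) root)

  on-generic-tangent : ∀ {x₀ x₁ x₂ b c} → dot (x₀ , x₁ , x₂) (1# , b , c) ≡ 0# → b * b ≡ four * c →
                       x₂ * (b * b) + (four * x₁) * b + four * x₀ ≡ 0#
  on-generic-tangent {x₀} {x₁} {x₂} {b} {c} on b²≡4c = begin
    x₂ * (b * b) + (four * x₁) * b + four * x₀    ≡⟨ cong (λ z → x₂ * z + (four * x₁) * b + four * x₀) b²≡4c ⟩
    x₂ * (four * c) + (four * x₁) * b + four * x₀ ≡⟨ solve 5 (λ x₀ x₁ x₂ b c → x₂ :* (con (+ 4) :* c) :+ (con (+ 4) :* x₁) :* b :+ con (+ 4) :* x₀
                                                        := con (+ 4) :* (x₀ :+ x₁ :* b :+ x₂ :* c)) refl x₀ x₁ x₂ b c ⟩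
    four * (x₀ + x₁ * b + x₂ * c)                 ≡⟨ cong (λ z → four * (z + x₁ * b + x₂ * c)) (*-identityʳ x₀) ⟨
    four * dot (x₀ , x₁ , x₂) (1# , b , c)        ≡⟨ cong (four *_) on ⟩
    four * 0#                                     ≡⟨ zeroʳ four ⟩
    0#                                            ∎

  on-vertex-tangent : ∀ {x₀ x₁ x₂} → dot (x₀ , x₁ , x₂) (0# , 0# , 1#) ≡ 0# → x₂ ≡ 0#
  on-vertex-tangent {x₀} {x₁} {x₂} on =
    trans (sym (trans (solve 4 (λ x₀ x₁ x₂ one → x₀ :* con (+ 0) :+ x₁ :* con (+ 0) :+ x₂ :* one := x₂ :* one) refl x₀ x₁ x₂ 1#)
                      (*-identityʳ x₂)))
          on

  private
    four·≡0 : ∀ {x} → four * x ≡ 0# → x ≡ 0#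
    four·≡0 {x} e with x*y≡0 four x e
    ... | inj₁ four≡0 = ⊥-elim (four≢0 four≡0)
    ... | inj₂ x≡0 = x≡0

    coefficients-zero : ∀ {x₀ x₁ x₂} → x₂ ≡ 0# × four * x₁ ≡ 0# × four * x₀ ≡ 0# → _≡_ {A = Triple} (x₀ , x₁ , x₂) zeroVec
    coefficients-zero (x₂≡0 , 4x₁≡0 , 4x₀≡0) = triple-≡ (four·≡0 4x₀≡0) (four·≡0 4x₁≡0) x₂≡0

    two-roots-with-x₂≡0 : ∀ {x₀ x₁ x₂ b b'} → x₂ ≡ 0# → b ≢ b' →
      x₂ * (b * b) + (four * x₁) * b + four * x₀ ≡ 0# → x₂ * (b' * b') + (four * x₁) * b' + four * x₀ ≡ 0# →
      _≡_ {A = Triple} (x₀ , x₁ , x₂) zeroVec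
    two-roots-with-x₂≡0 {x₀} {x₁} {_} {b} {b'} refl b≢b' root root' =
      coefficients-zero (refl , linear-two-roots (trans (linear b) root) (trans (linear b') root') b≢b')
      where
      linear : ∀ β → (four * x₁) * β + four * x₀ ≡ 0# * (β * β) + (four * x₁) * β + four * x₀
      linear β = solve 3 (λ q β r → q :* β :+ r := con (+ 0) :* (β :* β) :+ q :* β :+ r) refl (four * x₁) β (four * x₀)

  at-most-two-tangents : ∀ {x m₁ m₂ m₃} → x ≢ zeroVec → TangentForm m₁ → TangentForm m₂ → TangentForm m₃ →
    dot x m₁ ≡ 0# → dot x m₂ ≡ 0# → dot x m₃ ≡ 0# → m₁ ≡ m₂ ⊎ m₁ ≡ m₃ ⊎ m₂ ≡ m₃
  at-most-two-tangents _ vertex vertex _ _ _ _ = inj₁ refl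
  at-most-two-tangents _ vertex (generic _ _ _) vertex _ _ _ = inj₂ (inj₁ refl)
  at-most-two-tangents _ (generic _ _ _) vertex vertex _ _ _ = inj₂ (inj₂ refl)
  at-most-two-tangents {x₀ , x₁ , x₂} x≢0 (generic b₁ c₁ e₁) (generic b₂ c₂ e₂) (generic b₃ c₃ e₃) on₁ on₂ on₃
    with b₁ ≟ b₂ | b₁ ≟ b₃ | b₂ ≟ b₃
  ... | yes b₁≡b₂ | _ | _ = inj₁ (generic-≡ b₁≡b₂ e₁ e₂)
  ... | no _ | yes b₁≡b₃ | _ = inj₂ (inj₁ (generic-≡ b₁≡b₃ e₁ e₃))
  ... | no _ | no _ | yes b₂≡b₃ = inj₂ (inj₂ (generic-≡ b₂≡b₃ e₂ e₃))
  ... | no b₁≢b₂ | no b₁≢b₃ | no b₂≢b₃ = ⊥-elim (x≢0 (coefficients-zero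
    (quadratic-three-roots (on-generic-tangent on₁ e₁) (on-generic-tangent on₂ e₂) (on-generic-tangent on₃ e₃) b₁≢b₂ b₁≢b₃ b₂≢b₃)))
  at-most-two-tangents {x₀ , x₁ , x₂} x≢0 (generic b₁ c₁ e₁) (generic b₂ c₂ e₂) vertex on₁ on₂ on₃ with b₁ ≟ b₂
  ... | yes b₁≡b₂ = inj₁ (generic-≡ b₁≡b₂ e₁ e₂)
  ... | no b₁≢b₂ = ⊥-elim (x≢0 (two-roots-with-x₂≡0 (on-vertex-tangent on₃) b₁≢b₂ (on-generic-tangent on₁ e₁) (on-generic-tangent on₂ e₂)))
  at-most-two-tangents {x₀ , x₁ , x₂} x≢0 (generic b₁ c₁ e₁) vertex (generic b₃ c₃ e₃) on₁ on₂ on₃ with b₁ ≟ b₃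
  ... | yes b₁≡b₃ = inj₂ (inj₁ (generic-≡ b₁≡b₃ e₁ e₃))
  ... | no b₁≢b₃ = ⊥-elim (x≢0 (two-roots-with-x₂≡0 (on-vertex-tangent on₂) b₁≢b₃ (on-generic-tangent on₁ e₁) (on-generic-tangent on₃ e₃)))
  at-most-two-tangents {x₀ , x₁ , x₂} x≢0 vertex (generic b₂ c₂ e₂) (generic b₃ c₃ e₃) on₁ on₂ on₃ with b₂ ≟ b₃
  ... | yes b₂≡b₃ = inj₂ (inj₂ (generic-≡ b₂≡b₃ e₂ e₃))
  ... | no b₂≢b₃ = ⊥-elim (x≢0 (two-roots-with-x₂≡0 (on-vertex-tangent on₁) b₂≢b₃ (on-generic-tangent on₂ e₂) (on-generic-tangent on₃ e₃)))

  data OnConic : Triple → Set where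
    affine : ∀ t → OnConic (affinePoint t)
    atInfinity : OnConic pointAtInfinity

  onOᵇ⇒OnConic : ∀ x → onOᵇ x ≡ true → OnConic x
  onOᵇ⇒OnConic x on with any (λ t → eqTᵇ x (1# , t , t * t)) elements in affine?
  ... | true with any-true⁻ _ elements affine?
  ...   | t , _ , x≡ with refl ← eqTᵇ-sound _ _ x≡ = affine t
  onOᵇ⇒OnConic x on | false with refl ← eqTᵇ-sound _ _ on = atInfinity

  -- 4 (1 + t b + t² c) = (2 + t b)² + t² (4c − b²), so a point (1,t,t²) on a tangent [1,b,c] has t b = −2.
  affine-on-generic : ∀ {t b c} → b * b ≡ four * c → dot (affinePoint t) (1# , b , c) ≡ 0# → t * b ≡ - two
  affine-on-generic {t} {b} {c} b²≡4c on = x+y≡0⇒x≡-y (t * b) two (trans (+-comm _ two) (x*x≡0⇒x≡0 _ (begin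
    (two + t * b) * (two + t * b)                                   ≡⟨ +-identityʳ _ ⟨
    (two + t * b) * (two + t * b) + 0#                              ≡⟨ cong (λ z → (two + t * b) * (two + t * b) + z) t²·0≡0 ⟨
    (two + t * b) * (two + t * b) + (t * t) * (four * c − b * b)    ≡⟨ solve 3 (λ t b c →
        (con (+ 2) :+ t :* b) :* (con (+ 2) :+ t :* b) :+ (t :* t) :* (con (+ 4) :* c :- b :* b)
        := con (+ 4) :* (con (+ 1) :+ t :* b :+ (t :* t) :* c)) refl t b c ⟩
    four * (fromℕ 1 + t * b + (t * t) * c)                          ≡⟨ cong (λ z → four * (z + t * b + (t * t) * c)) 1≡1*1 ⟩
    four * dot (affinePoint t) (1# , b , c)                         ≡⟨ cong (four *_) on ⟩
    four * 0#                                                       ≡⟨ zeroʳ four ⟩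
    0#                                                              ∎)))
    where
    1≡1*1 : fromℕ 1 ≡ 1# * 1#
    1≡1*1 = trans (+-identityʳ 1#) (sym (*-identityʳ 1#))
    t²·0≡0 : (t * t) * (four * c − b * b) ≡ 0#
    t²·0≡0 = trans (cong ((t * t) *_) (trans (cong (_− b * b) (sym b²≡4c)) (-‿inverseʳ (b * b)))) (zeroʳ _)

  private
    -two≢0 : - two ≢ 0#
    -two≢0 e = two≢0 (trans (sym (-‿involutive two)) (trans (cong -_ e) -0#≈0#))

    affine-on-vertex : ∀ {t} → dot (affinePoint t) (0# , 0# , 1#) ≡ 0# → t ≡ 0#
    affine-on-vertex {t} on = x*x≡0⇒x≡0 t (trans (sym (trans
      (solve 2 (λ t one → one :* con (+ 0) :+ t :* con (+ 0) :+ (t :* t) :* one := (t :* t) :* one) refl t 1#)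
      (*-identityʳ (t * t)))) on)

    tb≢-2 : ∀ {t b} → t ≡ 0# → t * b ≢ - two
    tb≢-2 {b = b} refl e = -two≢0 (trans (sym e) (zeroˡ b))

  unique-tangent-at : ∀ {x m m'} → OnConic x → TangentForm m → TangentForm m' → dot x m ≡ 0# → dot x m' ≡ 0# → m ≡ m'
  unique-tangent-at (affine t) (generic b c e) (generic b' c' e') on on' =
    generic-≡ (*-cancelˡ t b b' t≢0 (trans tb≡-2 (sym (affine-on-generic e' on')))) e e'
    where
    tb≡-2 : t * b ≡ - two
    tb≡-2 = affine-on-generic e on
    t≢0 : t ≢ 0#
    t≢0 t≡0 = tb≢-2 t≡0 tb≡-2
  unique-tangent-at (affine t) (generic b c e) vertex on on' = ⊥-elim (tb≢-2 (affine-on-vertex on') (affine-on-generic e on))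
  unique-tangent-at (affine t) vertex (generic b c e) on on' = ⊥-elim (tb≢-2 (affine-on-vertex on) (affine-on-generic e on'))
  unique-tangent-at (affine t) vertex vertex on on' = refl
  unique-tangent-at atInfinity (generic b c e) (generic b' c' e') on on' = generic-≡ (trans (b≡0 e on) (sym (b≡0 e' on'))) e e'
    where
    b≡0 : ∀ {b c} → b * b ≡ four * c → dot pointAtInfinity (1# , b , c) ≡ 0# → b ≡ 0#
    b≡0 {b} {c} b²≡4c on = x*x≡0⇒x≡0 b (trans b²≡4c (trans (cong (four *_) (trans (sym (dot-pointAtInfinity 1# b c)) on)) (zeroʳ four)))
  unique-tangent-at atInfinity _ vertex _ on' = ⊥-elim (1≢0 (trans (sym (dot-pointAtInfinity 0# 0# 1#)) on'))
  unique-tangent-at atInfinity vertex _ on _ = ⊥-elim (1≢0 (trans (sym (dot-pointAtInfinity 0# 0# 1#)) on))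

  tangent-TangentForm : ∀ {m} → m ∈ allTriples → tangentᵇ m ≡ true → TangentForm m
  tangent-TangentForm m∈ = tangent⇒TangentForm (∈allTriples⇒normalized m∈)

  tangents-meet-externally : ∀ {ℓ m x} → Normalized ℓ → Normalized m → Normalized x →
    tangentᵇ ℓ ≡ true → tangentᵇ m ≡ true → ℓ ≢ m → dot x ℓ ≡ 0# → dot x m ≡ 0# → externalᵇ x ≡ true
  tangents-meet-externally {ℓ} {m} {x} nℓ nm nx tℓ tm ℓ≢m x·ℓ x·m = cong₂ _∧_ (cong not off-conic) (cong (ℕ._≡ᵇ 2) two-tangents)
    where
    off-conic : onOᵇ x ≡ false
    off-conic = Boolₚ.¬-not λ on → ℓ≢m (unique-tangent-at (onOᵇ⇒OnConic x on) (tangent⇒TangentForm nℓ tℓ) (tangent⇒TangentForm nm tm) x·ℓ x·m)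
    only-ℓ-m : ∀ n → n ∈ allTriples → (tangentᵇ n ∧ incᵇ x n) ≡ true → n ≡ ℓ ⊎ n ≡ m
    only-ℓ-m n n∈ tn∧x∈n with at-most-two-tangents (normalized≢zeroVec nx)
        (tangent⇒TangentForm nℓ tℓ) (tangent⇒TangentForm nm tm) (tangent-TangentForm n∈ (Boolₚ.∧-conicalˡ _ _ tn∧x∈n))
        x·ℓ x·m (incᵇ⇒dot≡0 (Boolₚ.∧-conicalʳ _ _ tn∧x∈n))
    ... | inj₁ ℓ≡m = ⊥-elim (ℓ≢m ℓ≡m)
    ... | inj₂ (inj₁ ℓ≡n) = inj₁ (sym ℓ≡n)
    ... | inj₂ (inj₂ m≡n) = inj₂ (sym m≡n)
    two-tangents : nTan x ≡ 2
    two-tangents = TripleCounting.count≡2 _ allTriples allTriples-unique ℓ m ℓ≢m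
      (normalized⇒∈allTriples nℓ) (normalized⇒∈allTriples nm)
      (cong₂ _∧_ tℓ (dot≡0⇒incᵇ x·ℓ)) (cong₂ _∧_ tm (dot≡0⇒incᵇ x·m)) only-ℓ-m

  internal⇒nTan≡0 : ∀ {p} → internalᵇ p ≡ true → nTan p ≡ 0
  internal⇒nTan≡0 {p} internal = ℕₚ.≡ᵇ⇒≡ (nTan p) 0 (Equivalence.from Boolₚ.T-≡ (Boolₚ.∧-conicalʳ _ _ internal))

  internal-off-tangents : ∀ {p m} → internalᵇ p ≡ true → m ∈ allTriples → tangentᵇ m ≡ true → dot p m ≢ 0#
  internal-off-tangents internal m∈ tm p·m≡0 with () ←
    trans (sym (cong₂ _∧_ tm (dot≡0⇒incᵇ p·m≡0))) (count≡0⇒false _ allTriples (internal⇒nTan≡0 internal) _ m∈)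

  internal≢external : ∀ {p x} → internalᵇ p ≡ true → externalᵇ x ≡ true → p ≢ x
  internal≢external {p} internal external refl with () ←
    trans (sym (internal⇒nTan≡0 internal)) (ℕₚ.≡ᵇ⇒≡ (nTan p) 2 (Equivalence.from Boolₚ.T-≡ (Boolₚ.∧-conicalʳ _ _ external)))

  pairing : Triple → Triple → Carrier
  pairing (m₀ , m₁ , m₂) (n₀ , n₁ , n₂) = four * (m₀ * n₂ + m₂ * n₀) − two * m₁ * n₁

  discriminant-−ᵥ : ∀ a b m n → discriminant (scale a m −ᵥ scale b n) ≡
    (a * a) * discriminant m + (b * b) * discriminant n + (a * b) * pairing m n
  discriminant-−ᵥ a b (m₀ , m₁ , m₂) (n₀ , n₁ , n₂) = solve 8 (λ a b m₀ m₁ m₂ n₀ n₁ n₂ →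
      (a :* m₁ :- b :* n₁) :* (a :* m₁ :- b :* n₁) :- con (+ 4) :* (a :* m₀ :- b :* n₀) :* (a :* m₂ :- b :* n₂)
      := (a :* a) :* (m₁ :* m₁ :- con (+ 4) :* m₀ :* m₂) :+ (b :* b) :* (n₁ :* n₁ :- con (+ 4) :* n₀ :* n₂)
         :+ (a :* b) :* (con (+ 4) :* (m₀ :* n₂ :+ m₂ :* n₀) :- con (+ 2) :* m₁ :* n₁))
    refl a b m₀ m₁ m₂ n₀ n₁ n₂

  pairing-of-tangents : ∀ {m n} → TangentForm m → TangentForm n → m ≢ n → ∃ λ e → e ≢ 0# × pairing m n ≡ e * e
  pairing-of-tangents (generic b c e) (generic b' c' e') m≢n = b − b' , b−b'≢0 , (begin
    four * (1# * c' + c * 1#) − two * b * b'                   ≡⟨ cong (λ u → four * u − two * b * b') (cong₂ _+_ (*-identityˡ c') (*-identityʳ c)) ⟩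
    four * (c' + c) − two * b * b'                             ≡⟨ solve 4 (λ b c b' c' → con (+ 4) :* (c' :+ c) :- con (+ 2) :* b :* b'
                                                                    := (b :- b') :* (b :- b') :+ ((con (+ 4) :* c' :- b' :* b') :+ (con (+ 4) :* c :- b :* b))) refl b c b' c' ⟩
    (b − b') * (b − b') + ((four * c' − b' * b') + (four * c − b * b)) ≡⟨ cong (λ u → (b − b') * (b − b') + u) (trans (cong₂ _+_ (vanish e') (vanish e)) (+-identityˡ 0#)) ⟩
    (b − b') * (b − b') + 0#                                   ≡⟨ +-identityʳ _ ⟩
    (b − b') * (b − b')                                        ∎)
    where
    b−b'≢0 : b − b' ≢ 0#
    b−b'≢0 h = m≢n (generic-≡ (x−y≡0⇒x≡y b b' h) e e')
    vanish : ∀ {b c} → b * b ≡ four * c → four * c − b * b ≡ 0#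
    vanish {b} b²≡4c = trans (cong (_− b * b) (sym b²≡4c)) (-‿inverseʳ (b * b))
  pairing-of-tangents (generic b c _) vertex _ = two , two≢0 , trans (cong (λ o → four * (o * o + c * 0#) − two * b * 0#) 1≡fromℕ1)
    (solve 2 (λ b c → con (+ 4) :* (con (+ 1) :* con (+ 1) :+ c :* con (+ 0)) :- con (+ 2) :* b :* con (+ 0) := con (+ 2) :* con (+ 2)) refl b c)
    where 1≡fromℕ1 = sym (+-identityʳ 1#)
  pairing-of-tangents vertex (generic b c _) _ = two , two≢0 , trans (cong (λ o → four * (0# * c + o * o) − two * 0# * b) 1≡fromℕ1)
    (solve 2 (λ b c → con (+ 4) :* (con (+ 0) :* c :+ con (+ 1) :* con (+ 1)) :- con (+ 2) :* con (+ 0) :* b := con (+ 2) :* con (+ 2)) refl b c)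
    where 1≡fromℕ1 = sym (+-identityʳ 1#)
  pairing-of-tangents vertex vertex m≢n = ⊥-elim (m≢n refl)

  isSquare-discriminant-scale : ∀ k v → k ≢ 0# → isSquare (discriminant (scale k v)) ≡ isSquare (discriminant v)
  isSquare-discriminant-scale k v k≢0 = trans (cong isSquare (discriminant-scale k v)) (isSquare-*-square k _ k≢0)

  -- The only line through p ≠ x is the one with coordinates p × x.
  passant-through≡nonsquare : ∀ {p x} → Normalized p → Normalized x → p ≢ x →
    any (λ m → passantᵇ m ∧ incᵇ p m ∧ incᵇ x m) allTriples ≡ not (isSquare (discriminant (cross p x)))
  passant-through≡nonsquare {p} {x} np nx p≢x = bool-ext to from
    where
    v = cross p x
    v≢0 : v ≢ zeroVec
    v≢0 = cross≢zeroVec np nx p≢x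
    to : any (λ m → passantᵇ m ∧ incᵇ p m ∧ incᵇ x m) allTriples ≡ true → not (isSquare (discriminant v)) ≡ true
    to h with any-true⁻ _ allTriples h
    ... | m , m∈ , pas∧on = line-is-multiple (meet-on-both m p x (trans (dot-comm m p) p·m) (trans (dot-comm m x) x·m) np nx p≢x)
      where
      pas : passantᵇ m ≡ true
      pas = Boolₚ.∧-conicalˡ (passantᵇ m) _ pas∧on
      p∈m∧x∈m : (incᵇ p m ∧ incᵇ x m) ≡ true
      p∈m∧x∈m = Boolₚ.∧-conicalʳ (passantᵇ m) (incᵇ p m ∧ incᵇ x m) pas∧on
      p·m : dot p m ≡ 0#
      p·m = incᵇ⇒dot≡0 (Boolₚ.∧-conicalˡ (incᵇ p m) (incᵇ x m) p∈m∧x∈m)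
      x·m : dot x m ≡ 0#
      x·m = incᵇ⇒dot≡0 (Boolₚ.∧-conicalʳ (incᵇ p m) (incᵇ x m) p∈m∧x∈m)
      line-is-multiple : (∃ λ k → m ≡ scale k v) → not (isSquare (discriminant v)) ≡ true
      line-is-multiple (k , refl) = begin
        not (isSquare (discriminant v))            ≡⟨ cong not (isSquare-discriminant-scale k v k≢0) ⟨
        not (isSquare (discriminant (scale k v)))  ≡⟨ passant≡nonsquare-discriminant (scale k v) ⟨
        passantᵇ (scale k v)                       ≡⟨ pas ⟩
        true                                       ∎
        where
        k≢0 : k ≢ 0#
        k≢0 = scale≢zeroVec⇒≢0 k v (normalized≢zeroVec (∈allTriples⇒normalized m∈))
    from : not (isSquare (discriminant v)) ≡ true → any (λ m → passantᵇ m ∧ incᵇ p m ∧ incᵇ x m) allTriples ≡ true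
    from h with normalize v v≢0
    ... | k , k≢0 , nm = any-true⁺ _ (normalized⇒∈allTriples nm) (cong₂ _∧_ passant (cong₂ _∧_
          (dot≡0⇒incᵇ (trans (dot-comm p (scale k v)) (scale-on k (dot-cross-left p x))))
          (dot≡0⇒incᵇ (trans (dot-comm x (scale k v)) (scale-on k (dot-cross-right p x))))))
      where
      passant : passantᵇ (scale k v) ≡ true
      passant = trans (passant≡nonsquare-discriminant (scale k v)) (trans (cong not (isSquare-discriminant-scale k v k≢0)) h)

  -- Writing x = k (m × n), the line px is k ((p·n) m − (p·m) n), whose discriminant is
  -- (p·m)(p·n) times the nonzero square pairing m n, as m and n have discriminant 0.
  isSquare-join-with-tangent-meet : ∀ p {m n x} → Normalized m → Normalized n → Normalized x →
    tangentᵇ m ≡ true → tangentᵇ n ≡ true → m ≢ n → dot x m ≡ 0# → dot x n ≡ 0# →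
    isSquare (discriminant (cross p x)) ≡ isSquare (dot p m * dot p n)
  isSquare-join-with-tangent-meet p {m} {n} {x} nm nn nx tm tn m≢n x·m x·n =
    with-witnesses (meet-on-both x m n x·m x·n nm nn m≢n)
      (pairing-of-tangents (tangent⇒TangentForm nm tm) (tangent⇒TangentForm nn tn) m≢n)
    where
    w = cross m n
    pm = dot p m
    pn = dot p n
    with-witnesses : (∃ λ k → x ≡ scale k w) → (∃ λ e → e ≢ 0# × pairing m n ≡ e * e) →
                     isSquare (discriminant (cross p x)) ≡ isSquare (pm * pn)
    with-witnesses (k , refl) (e , e≢0 , pairing≡e²) = begin
      isSquare (discriminant (cross p (scale k w)))             ≡⟨ cong (λ u → isSquare (discriminant u)) (cross-scaleʳ p k w) ⟩
      isSquare (discriminant (scale k (cross p w)))             ≡⟨ isSquare-discriminant-scale k (cross p w) k≢0 ⟩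
      isSquare (discriminant (cross p w))                       ≡⟨ cong (λ u → isSquare (discriminant u)) (cross-cross p m n) ⟩
      isSquare (discriminant (scale pn m −ᵥ scale pm n))        ≡⟨ cong isSquare (trans (discriminant-−ᵥ pn pm m n) reduce) ⟩
      isSquare ((pm * pn) * (e * e))                            ≡⟨ cong isSquare (*-comm (pm * pn) (e * e)) ⟩
      isSquare ((e * e) * (pm * pn))                            ≡⟨ isSquare-*-square e _ e≢0 ⟩
      isSquare (pm * pn)                                        ∎
      where
      k≢0 : k ≢ 0#
      k≢0 = scale≢zeroVec⇒≢0 k w (normalized≢zeroVec nx)
      reduce : (pn * pn) * discriminant m + (pm * pm) * discriminant n + (pn * pm) * pairing m n ≡ (pm * pn) * (e * e)
      reduce = begin
        (pn * pn) * discriminant m + (pm * pm) * discriminant n + (pn * pm) * pairing m n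
          ≡⟨ cong₂ (λ u v → (pn * pn) * u + (pm * pm) * v + (pn * pm) * pairing m n) (tangent⇒discriminant≡0 m tm) (tangent⇒discriminant≡0 n tn) ⟩
        (pn * pn) * 0# + (pm * pm) * 0# + (pn * pm) * pairing m n
          ≡⟨ cong (λ u → (pn * pn) * 0# + (pm * pm) * 0# + (pn * pm) * u) pairing≡e² ⟩
        (pn * pn) * 0# + (pm * pm) * 0# + (pn * pm) * (e * e)
          ≡⟨ solve 3 (λ pm pn e → (pn :* pn) :* con (+ 0) :+ (pm :* pm) :* con (+ 0) :+ (pn :* pm) :* (e :* e) := (pm :* pn) :* (e :* e)) refl pm pn e ⟩
        (pm * pn) * (e * e) ∎

  T-membership : ∀ p {ℓ m x} → Normalized ℓ → Normalized m → Normalized x → tangentᵇ m ≡ true → ℓ ≢ m →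
    dot x ℓ ≡ 0# → dot x m ≡ 0# → inTᵇ p ℓ m ≡ inNᵇ p x
  T-membership p {ℓ} {m} {x} nℓ nm nx tm ℓ≢m x·ℓ x·m =
    trans (cong₂ (λ a b → a ∧ not b ∧ via-meet) tm (eqTᵇ-complete m ℓ (λ e → ℓ≢m (sym e)))) (bool-ext to from)
    where
    via-meet = any (λ r → inNᵇ p r ∧ incᵇ r ℓ ∧ incᵇ r m) allTriples
    to : via-meet ≡ true → inNᵇ p x ≡ true
    to h with any-true⁻ _ allTriples h
    ... | r , r∈ , r∈N∧on = subst (λ u → inNᵇ p u ≡ true)
          (meet-unique nℓ nm ℓ≢m nx (∈allTriples⇒normalized r∈) x·ℓ x·m (incᵇ⇒dot≡0 r∈ℓ) (incᵇ⇒dot≡0 r∈m)) r∈N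
      where
      r∈N : inNᵇ p r ≡ true
      r∈N = Boolₚ.∧-conicalˡ (inNᵇ p r) _ r∈N∧on
      r∈ℓ∧r∈m : (incᵇ r ℓ ∧ incᵇ r m) ≡ true
      r∈ℓ∧r∈m = Boolₚ.∧-conicalʳ (inNᵇ p r) (incᵇ r ℓ ∧ incᵇ r m) r∈N∧on
      r∈ℓ : incᵇ r ℓ ≡ true
      r∈ℓ = Boolₚ.∧-conicalˡ (incᵇ r ℓ) (incᵇ r m) r∈ℓ∧r∈m
      r∈m : incᵇ r m ≡ true
      r∈m = Boolₚ.∧-conicalʳ (incᵇ r ℓ) (incᵇ r m) r∈ℓ∧r∈m
    from : inNᵇ p x ≡ true → via-meet ≡ true
    from h = any-true⁺ _ (normalized⇒∈allTriples nx) (cong₂ _∧_ h (cong₂ _∧_ (dot≡0⇒incᵇ x·ℓ) (dot≡0⇒incᵇ x·m)))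

  N-membership-at-tangent-meet : ∀ {p m n x} → Normalized p → internalᵇ p ≡ true → Normalized m → Normalized n → Normalized x →
    tangentᵇ m ≡ true → tangentᵇ n ≡ true → m ≢ n → dot x m ≡ 0# → dot x n ≡ 0# →
    inNᵇ p x ≡ (isSquare (dot p m) xor isSquare (dot p n))
  N-membership-at-tangent-meet {p} {m} {n} {x} np internal nm nn nx tm tn m≢n x·m x·n = begin
    inNᵇ p x                                                      ≡⟨ cong (_∧ any (λ l → passantᵇ l ∧ incᵇ p l ∧ incᵇ x l) allTriples) external ⟩
    any (λ l → passantᵇ l ∧ incᵇ p l ∧ incᵇ x l) allTriples       ≡⟨ passant-through≡nonsquare np nx (internal≢external internal external) ⟩
    not (isSquare (discriminant (cross p x)))                     ≡⟨ cong not (isSquare-join-with-tangent-meet p nm nn nx tm tn m≢n x·m x·n) ⟩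
    not (isSquare (dot p m * dot p n))                            ≡⟨ cong not (isSquare-* _ _ (off nm tm) (off nn tn)) ⟩
    not (not (isSquare (dot p m) xor isSquare (dot p n)))         ≡⟨ Boolₚ.not-involutive _ ⟩
    isSquare (dot p m) xor isSquare (dot p n)                     ∎
    where
    external : externalᵇ x ≡ true
    external = tangents-meet-externally nm nn nx tm tn m≢n x·m x·n
    off : ∀ {l} → Normalized l → tangentᵇ l ≡ true → dot p l ≢ 0#
    off nl tl = internal-off-tangents internal (normalized⇒∈allTriples nl) tl

module ExternalPointParity (F : FiniteField) (odd : FiniteField.order F % 2 ≡ 1) where
  open Field F
  open Squares F odd
  open PG2 F
  open Counting F
  open Coordinates F
  open Conic F odd
  open ≡-Reasoning

  χN≡toℕ : ∀ P Q → χN P Q ≡ + toℕ (inNᵇ (proj₁ P) (proj₁ Q))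
  χN≡toℕ (p , _) (q , _) with inNᵇ p q
  ... | true = refl
  ... | false = refl

  sumT≡count : ∀ P ℓP Q → externalᵇ (proj₁ Q) ≡ true →
    sumT P ℓP Q ≡ + count (λ m → inTᵇ (proj₁ P) (proj₁ ℓP) m ∧ incᵇ (proj₁ Q) m) allTriples
  sumT≡count (p , _) (ℓ , _) (q , _) external rewrite external = fold allTriples
    where
    fold : ∀ ms → Data.List.foldr (λ m acc → (if inTᵇ p ℓ m then (if incᵇ q m then + 1 else + 0) else + 0) ℤ.+ acc) (+ 0) ms
                  ≡ + count (λ m → inTᵇ p ℓ m ∧ incᵇ q m) ms
    fold [] = refl
    fold (m ∷ ms) with inTᵇ p ℓ m | incᵇ q m
    ... | true | true = cong (λ i → + 1 ℤ.+ i) (fold ms)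
    ... | true | false = trans (ℤₚ.+-identityˡ _) (fold ms)
    ... | false | _ = trans (ℤₚ.+-identityˡ _) (fold ms)

  module AtExternalPoint {p ℓ q : Triple} (np : Normalized p) (internal : internalᵇ p ≡ true)
                         (nℓ : Normalized ℓ) (tℓ : tangentᵇ ℓ ≡ true) (nq : Normalized q) (external : externalᵇ q ≡ true) where

    tangentThrough-q : Triple → Bool
    tangentThrough-q n = tangentᵇ n ∧ incᵇ q n

    inT-through-q : Triple → Bool
    inT-through-q m = inTᵇ p ℓ m ∧ incᵇ q m

    two-tangents : count tangentThrough-q allTriples ≡ 2
    two-tangents = ℕₚ.≡ᵇ⇒≡ _ 2 (Equivalence.from Boolₚ.T-≡ (Boolₚ.∧-conicalʳ (not (onOᵇ q)) _ external))

    open TwoWitnesses (count≡2⇒witnesses tangentThrough-q allTriples two-tangents)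
      renaming (first to m₁; second to m₂; p-first to tangent-m₁; p-second to tangent-m₂)

    m₁≢m₂ : m₁ ≢ m₂
    m₁≢m₂ = distinct allTriples-unique

    normalized-m₁ : Normalized m₁
    normalized-m₁ = ∈allTriples⇒normalized first∈

    normalized-m₂ : Normalized m₂
    normalized-m₂ = ∈allTriples⇒normalized second∈

    tangent : ∀ {m} → tangentThrough-q m ≡ true → tangentᵇ m ≡ true
    tangent {m} h = Boolₚ.∧-conicalˡ (tangentᵇ m) (incᵇ q m) h

    through-q : ∀ {m} → tangentThrough-q m ≡ true → dot q m ≡ 0#
    through-q {m} h = incᵇ⇒dot≡0 (Boolₚ.∧-conicalʳ (tangentᵇ m) (incᵇ q m) h)

    #T-through-q : count inT-through-q allTriples ≡ toℕ (inT-through-q m₁) ℕ.+ toℕ (inT-through-q m₂)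
    #T-through-q = count-below inT-through-q λ m h →
      cong₂ _∧_ (Boolₚ.∧-conicalˡ (tangentᵇ m) _ (Boolₚ.∧-conicalˡ (inTᵇ p ℓ m) (incᵇ q m) h)) (Boolₚ.∧-conicalʳ (inTᵇ p ℓ m) (incᵇ q m) h)

    inT-through-q-at-meet : ∀ {m x} → tangentThrough-q m ≡ true → Normalized m → ℓ ≢ m → Normalized x →
      dot x ℓ ≡ 0# → dot x m ≡ 0# → inT-through-q m ≡ inNᵇ p x
    inT-through-q-at-meet {m} h nm ℓ≢m nx x·ℓ x·m =
      trans (cong (inTᵇ p ℓ m ∧_) (Boolₚ.∧-conicalʳ (tangentᵇ m) (incᵇ q m) h))
            (trans (Boolₚ.∧-identityʳ _) (T-membership p nℓ nm nx (tangent h) ℓ≢m x·ℓ x·m))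

    χ : Triple → Bool
    χ m = isSquare (dot p m)

    inN-q : inNᵇ p q ≡ (χ m₁ xor χ m₂)
    inN-q = N-membership-at-tangent-meet np internal normalized-m₁ normalized-m₂ nq
      (tangent tangent-m₁) (tangent tangent-m₂) m₁≢m₂ (through-q tangent-m₁) (through-q tangent-m₂)

    parity-off-ℓ : incᵇ q ℓ ≡ false → ∃ λ k → toℕ (inNᵇ p q) ℕ.+ count inT-through-q allTriples ≡ k ℕ.+ k
    parity-off-ℓ q∉ℓ = proj₁ (xor-parity (χ ℓ) (χ m₁) (χ m₂)) , (begin
      toℕ (inNᵇ p q) ℕ.+ count inT-through-q allTriples
        ≡⟨ cong₂ ℕ._+_ (cong toℕ inN-q) (trans #T-through-q (cong₂ ℕ._+_ (cong toℕ (via-meet tangent-m₁ normalized-m₁)) (cong toℕ (via-meet tangent-m₂ normalized-m₂)))) ⟩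
      toℕ (χ m₁ xor χ m₂) ℕ.+ (toℕ (χ ℓ xor χ m₁) ℕ.+ toℕ (χ ℓ xor χ m₂))
        ≡⟨ proj₂ (xor-parity (χ ℓ) (χ m₁) (χ m₂)) ⟩
      _ ∎)
      where
      ℓ≢ : ∀ {m} → tangentThrough-q m ≡ true → ℓ ≢ m
      ℓ≢ {m} h refl with () ← trans (sym (Boolₚ.∧-conicalʳ (tangentᵇ m) (incᵇ q m) h)) q∉ℓ
      via-meet : ∀ {m} → tangentThrough-q m ≡ true → Normalized m → inT-through-q m ≡ (χ ℓ xor χ m)
      via-meet {m} h nm = at (meet-point nℓ nm (ℓ≢ h))
        where
        at : (∃ λ x → Normalized x × dot x ℓ ≡ 0# × dot x m ≡ 0#) → inT-through-q m ≡ (χ ℓ xor χ m)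
        at (x , nx , x·ℓ , x·m) = trans (inT-through-q-at-meet h nm (ℓ≢ h) nx x·ℓ x·m)
          (N-membership-at-tangent-meet np internal nℓ nm nx tℓ (tangent h) (ℓ≢ h) x·ℓ x·m)

    ℓ∉T : inT-through-q ℓ ≡ false
    ℓ∉T rewrite tℓ | eqTᵇ-refl ℓ = refl

    other-tangent : incᵇ q ℓ ≡ true → ∀ {m} → tangentThrough-q m ≡ true → Normalized m → ℓ ≢ m → inT-through-q m ≡ inNᵇ p q
    other-tangent q∈ℓ h nm ℓ≢m = inT-through-q-at-meet h nm ℓ≢m nq (incᵇ⇒dot≡0 q∈ℓ) (through-q h)

    parity-on-ℓ : incᵇ q ℓ ≡ true → ∃ λ k → toℕ (inNᵇ p q) ℕ.+ count inT-through-q allTriples ≡ k ℕ.+ k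
    parity-on-ℓ q∈ℓ with only ℓ (normalized⇒∈allTriples nℓ) (cong₂ _∧_ tℓ q∈ℓ)
    ... | inj₁ refl = toℕ (inNᵇ p q) , cong (toℕ (inNᵇ p q) ℕ.+_) (trans #T-through-q
          (cong₂ ℕ._+_ (cong toℕ ℓ∉T) (cong toℕ (other-tangent q∈ℓ tangent-m₂ normalized-m₂ m₁≢m₂))))
    ... | inj₂ refl = toℕ (inNᵇ p q) , cong (toℕ (inNᵇ p q) ℕ.+_) (trans #T-through-q (trans
          (cong₂ ℕ._+_ (cong toℕ (other-tangent q∈ℓ tangent-m₁ normalized-m₁ (λ e → m₁≢m₂ (sym e)))) (cong toℕ ℓ∉T))
          (ℕₚ.+-identityʳ _)))

    parity : ∃ λ k → toℕ (inNᵇ p q) ℕ.+ count inT-through-q allTriples ≡ k ℕ.+ k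
    parity with incᵇ q ℓ in q∈ℓ
    ... | true = parity-on-ℓ q∈ℓ
    ... | false = parity-off-ℓ q∈ℓ

corollary2p17 : (F : FiniteField) → FiniteField.order F % 2 ≡ 1 →
    let open PG2 F in
    (P : Pt) → Internal P →
    (ℓP : Line) → Tangent ℓP →
    Σ Pt (λ R → External R × (R on perp (proj₁ P)) × (R on proj₁ ℓP)) →
    (Q : Pt) → External Q →
    (+ 2) ∣ (χN P Q - sumT P ℓP Q)
corollary2p17 F odd P@(p , np) internal ℓP@(ℓ , nℓ) tangent _ Q@(q , nq) external =
  subst ((+ 2) ∣_) (sym (cong₂ _-_ (χN≡toℕ P Q) (sumT≡count P ℓP Q externalᵇ≡true)))
    (even-sum⇒2∣difference (toℕ (PG2.inNᵇ F p q)) _ (proj₁ parity) (proj₂ parity))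
  where
  open ExternalPointParity F odd
  externalᵇ≡true : PG2.externalᵇ F q ≡ true
  externalᵇ≡true = Equivalence.to Boolₚ.T-≡ external
  open AtExternalPoint np (Equivalence.to Boolₚ.T-≡ internal) nℓ (Equivalence.to Boolₚ.T-≡ tangent) nq externalᵇ≡true
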